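{- Let $\Gamma$ be a set of second-order formulas (a context) and $A$ a second-order formula, and let $k\in\{i,c\}$. If $\Gamma^*,SC_1\vdash^1_k A^*$, then $\Gamma\vdash^2_k A$.
   Context: The second-order language $\mathcal L_2$ has logical symbols $\bot,\to,\wedge,\vee,\forall,\exists$; a countable set $\mathcal V$ of first-order variables; a countable set $\Sigma$ of function symbols (constants have arity $0$), from which terms are built; and for each $n\in\mathbb N$ a countable set $\mathcal V_n$ of second-order variables of arity $n$. Its atomic formulas are $\bot$ and $X^n(t_1,\dots,t_n)$, and it has quantification over first-order variables and over second-order variables of every arity. The first-order language $\mathcal L_1$ has the same $\mathcal V$, $\Sigma$ and logical symbols, and for each $n\in\mathbb N$ one relation symbol $\mathrm{Ap}_n$ of arity $n+1$ (and no others). $\mathrm{Free}(F)$ denotes the set of free variables, and $F\leftrightarrow G$ abbreviates $(F\to G)\wedge(G\to F)$. $\Gamma\vdash^n_k F$ denotes natural-deduction derivability, in first-order logic over $\mathcal L_1$ for $n=1$ and in second-order logic over $\mathcal L_2$ for $n=2$ (where second-order $\forall$-elimination and $\exists$-introduction instantiate $X^n$ by an arbitrary abstraction $\lambda x_1\dots x_n\,G$); the logic is intuitionistic for $k=i$ and classical for $k=c$. Fix for each $n$ a bijection $\phi_n:\mathcal V_n\to\mathcal V$. The coding $F\mapsto F^*$ of $\mathcal L_2$-formulas into $\mathcal L_1$-formulas is defined by: - $\bot^*=\bot$ and $(X^n(t_1,\dots,t_n))^*=\mathrm{Ap}_n(\phi_n(X^n),t_1,\dots,t_n)$. - $(A\diamond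 B)^*=A^*\diamond B^*$ for $\diamond\in\{\to,\wedge,\vee\}$. - $(Qx\,A)^*=Qy\,(A[x:=y])^*$ for a variable $y\notin\mathrm{Free}(A^*)$. - $(QX^n\,A)^*=Qy\,(A[X^n:=Y^n])^*$, where $\phi_n(Y^n)=y$ and $y\notin\mathrm{Free}(A^*)$. Here $Q\in\{\forall,\exists\}$. For a set of formulas, $\Gamma^*=\{F^*:F\in\Gamma\}$. $SC_2$ is the set of all closed $\mathcal L_2$-formulas $\forall\chi_1\dots\forall\chi_m\,\exists X^n\,\forall x_1\dots\forall x_n\,(G\leftrightarrow X^n(x_1,\dots,x_n))$, where $x_j\in\mathcal V$, the $\chi_j$ are first- or second-order variables, $\mathrm{Free}(G)\subseteq\{x_1,\dots,x_n,\chi_1,\dots,\chi_m\}$, and $X^n\notin\mathrm{Free}(G)$. Finally, $SC_1=\{F^*:F\in SC_2\}$. -}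

module Defs where

open import Data.Nat using (ℕ; zero; suc)
open import Data.List using (List; []; _∷_; _++_; replicate; map)
open import Data.List.Relation.Unary.All using (All)
open import Data.List.Membership.Propositional using (_∈_)
open import Data.Vec using (Vec; []; _∷_; _∷ʳ_)
open import Data.Product using (Σ; _×_; _,_)
open import Data.Sum using (_⊎_; inj₁; inj₂)
open import Data.Empty using (⊥)
open import Relation.Nullary using (¬_)
open import Relation.Binary.PropositionalEquality using (_≡_)
open import Function using (_∘_)
open import Function.Bundles using (_↣_; _⤖_; Bijection)

-- Signature: a countable set Σ of function symbols with arities.
-- First-order variables V, and each V_n, are taken to be ℕ.

record Signature : Set₁ where
  field
    Fun       : Set
    arity     : Fun → ℕ
    countable : Fun ↣ ℕ

data Logic : Set where
  int cla : Logic

-- Locally nameless syntax: free variables are names (ℕ), bound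
-- variables are well-scoped de Bruijn references into a context of
-- binder kinds (first-order, or second-order of arity n).

data Kind : Set where
  fo : Kind
  so : ℕ → Kind

Ctx : Set
Ctx = List Kind

infix 4 _∋_
data _∋_ : Ctx → Kind → Set where
  here  : ∀ {Δ k} → (k ∷ Δ) ∋ k
  there : ∀ {Δ k k'} → Δ ∋ k → (k' ∷ Δ) ∋ k

Ren : Ctx → Ctx → Set
Ren Δ Δ' = ∀ {k} → Δ ∋ k → Δ' ∋ k

liftR : ∀ {Δ Δ' k} → Ren Δ Δ' → Ren (k ∷ Δ) (k ∷ Δ')
liftR ρ here      = here
liftR ρ (there i) = there (ρ i)

fos : ℕ → Ctx
fos n = replicate n fo

liftN : ∀ {Δ Δ'} (m : ℕ) → Ren Δ Δ' → Ren (fos m ++ Δ) (fos m ++ Δ')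
liftN zero    ρ = ρ
liftN (suc m) ρ = liftR (liftN m ρ)

wkFos : ∀ {Δ k} (m : ℕ) → Δ ∋ k → (fos m ++ Δ) ∋ k
wkFos zero    i = i
wkFos (suc m) i = there (wkFos m i)

-- the coding collapses every binder to a first-order binder
⌜_⌝ : Ctx → Ctx
⌜ Δ ⌝ = map (λ _ → fo) Δ

cv : ∀ {Δ k} → Δ ∋ k → ⌜ Δ ⌝ ∋ fo
cv here      = here
cv (there i) = there (cv i)

module _ (S : Signature) where
  open Signature S

  data Term (Δ : Ctx) : Set where
    bvar : Δ ∋ fo → Term Δ
    fvar : ℕ → Term Δ
    fun  : (f : Fun) → Vec (Term Δ) (arity f) → Term Δ

  mutual
    subT : ∀ {Δ Δ'} → (Δ ∋ fo → Term Δ') → Term Δ → Term Δ'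
    subT σ (bvar i)   = σ i
    subT σ (fvar x)   = fvar x
    subT σ (fun f ts) = fun f (subTs σ ts)

    subTs : ∀ {Δ Δ' n} → (Δ ∋ fo → Term Δ') → Vec (Term Δ) n → Vec (Term Δ') n
    subTs σ []       = []
    subTs σ (t ∷ ts) = subT σ t ∷ subTs σ ts

  renT : ∀ {Δ Δ'} → Ren Δ Δ' → Term Δ → Term Δ'
  renT ρ = subT (bvar ∘ ρ)

  mutual
    FOT : ∀ {Δ} → ℕ → Term Δ → Set
    FOT x (bvar i)   = ⊥
    FOT x (fvar y)   = x ≡ y
    FOT x (fun f ts) = FOTs x ts

    FOTs : ∀ {Δ n} → ℕ → Vec (Term Δ) n → Set
    FOTs x []       = ⊥
    FOTs x (t ∷ ts) = FOT x t ⊎ FOTs x ts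

  data SVar (Δ : Ctx) (n : ℕ) : Set where
    bound : Δ ∋ so n → SVar Δ n
    free  : ℕ → SVar Δ n

  infixr 5 _⇒_
  infixr 6 _∧_ _∨_

  data Form2 (Δ : Ctx) : Set where
    ⊥ᶠ      : Form2 Δ
    app     : (n : ℕ) → SVar Δ n → Vec (Term Δ) n → Form2 Δ
    _⇒_ _∧_ _∨_ : Form2 Δ → Form2 Δ → Form2 Δ
    ∀₁ ∃₁   : Form2 (fo ∷ Δ) → Form2 Δ
    ∀₂ ∃₂   : (n : ℕ) → Form2 (so n ∷ Δ) → Form2 Δ

  _⇔_ : ∀ {Δ} → Form2 Δ → Form2 Δ → Form2 Δ
  A ⇔ B = (A ⇒ B) ∧ (B ⇒ A)

  renSV : ∀ {Δ Δ' n} → Ren Δ Δ' → SVar Δ n → SVar Δ' n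
  renSV ρ (bound i) = bound (ρ i)
  renSV ρ (free X)  = free X

  renF2 : ∀ {Δ Δ'} → Ren Δ Δ' → Form2 Δ → Form2 Δ'
  renF2 ρ ⊥ᶠ          = ⊥ᶠ
  renF2 ρ (app n v ts) = app n (renSV ρ v) (subTs (bvar ∘ ρ) ts)
  renF2 ρ (A ⇒ B)     = renF2 ρ A ⇒ renF2 ρ B
  renF2 ρ (A ∧ B)     = renF2 ρ A ∧ renF2 ρ B
  renF2 ρ (A ∨ B)     = renF2 ρ A ∨ renF2 ρ B
  renF2 ρ (∀₁ A)      = ∀₁ (renF2 (liftR ρ) A)
  renF2 ρ (∃₁ A)      = ∃₁ (renF2 (liftR ρ) A)
  renF2 ρ (∀₂ n A)    = ∀₂ n (renF2 (liftR ρ) A)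
  renF2 ρ (∃₂ n A)    = ∃₂ n (renF2 (liftR ρ) A)

  Val1 : Kind → Ctx → Set
  Val1 fo     Δ = Term Δ
  Val1 (so n) Δ = SVar Δ n

  Sub1 : Ctx → Ctx → Set
  Sub1 Δ Δ' = ∀ {k} → Δ ∋ k → Val1 k Δ'

  idv1 : ∀ {Δ k} → Δ ∋ k → Val1 k Δ
  idv1 {k = fo}   i = bvar i
  idv1 {k = so n} i = bound i

  wkV1 : ∀ {Δ k k'} → Val1 k Δ → Val1 k (k' ∷ Δ)
  wkV1 {k = fo}   t = renT there t
  wkV1 {k = so n} v = renSV there v

  lift1 : ∀ {Δ Δ' k'} → Sub1 Δ Δ' → Sub1 (k' ∷ Δ) (k' ∷ Δ')
  lift1 σ here      = idv1 here
  lift1 σ (there i) = wkV1 (σ i)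

  sub1 : ∀ {Δ Δ'} → Sub1 Δ Δ' → Form2 Δ → Form2 Δ'
  sub1 σ ⊥ᶠ                 = ⊥ᶠ
  sub1 σ (app n (bound i) ts) = app n (σ i) (subTs σ ts)
  sub1 σ (app n (free X) ts)  = app n (free X) (subTs σ ts)
  sub1 σ (A ⇒ B)            = sub1 σ A ⇒ sub1 σ B
  sub1 σ (A ∧ B)            = sub1 σ A ∧ sub1 σ B
  sub1 σ (A ∨ B)            = sub1 σ A ∨ sub1 σ B
  sub1 σ (∀₁ A)             = ∀₁ (sub1 (lift1 σ) A)
  sub1 σ (∃₁ A)             = ∃₁ (sub1 (lift1 σ) A)
  sub1 σ (∀₂ n A)           = ∀₂ n (sub1 (lift1 σ) A)
  sub1 σ (∃₂ n A)           = ∃₂ n (sub1 (lift1 σ) A)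

  -- instantiating the n bound variables of an abstraction body by terms
  -- (the i-th argument replaces the bound variable with de Bruijn index i)
  inst : ∀ {Δ n} → Vec (Term Δ) n → Sub1 (fos n ++ Δ) Δ
  inst []       i         = idv1 i
  inst (t ∷ ts) here      = t
  inst (t ∷ ts) (there i) = inst ts i

  -- second-order substitution: a second-order variable X^n is replaced
  -- by a variable or by an abstraction λx₁…xₙ G  (G : Form2 (fos n ++ Δ))
  Val2 : Kind → Ctx → Set
  Val2 fo     Δ = Term Δ
  Val2 (so n) Δ = SVar Δ n ⊎ Form2 (fos n ++ Δ)

  Sub2 : Ctx → Ctx → Set
  Sub2 Δ Δ' = ∀ {k} → Δ ∋ k → Val2 k Δ'

  wkV2 : ∀ {Δ k k'} → Val2 k Δ → Val2 k (k' ∷ Δ)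
  wkV2 {k = fo}   t        = renT there t
  wkV2 {k = so n} (inj₁ v) = inj₁ (renSV there v)
  wkV2 {k = so n} (inj₂ G) = inj₂ (renF2 (liftN n there) G)

  idv2 : ∀ {Δ k} → Δ ∋ k → Val2 k Δ
  idv2 {k = fo}   i = bvar i
  idv2 {k = so n} i = inj₁ (bound i)

  lift2 : ∀ {Δ Δ' k'} → Sub2 Δ Δ' → Sub2 (k' ∷ Δ) (k' ∷ Δ')
  lift2 σ here      = idv2 here
  lift2 σ (there i) = wkV2 (σ i)

  appV : ∀ {Δ n} → Val2 (so n) Δ → Vec (Term Δ) n → Form2 Δ
  appV {n = n} (inj₁ v) ts = app n v ts
  appV         (inj₂ G) ts = sub1 (inst ts) G

  sub2 : ∀ {Δ Δ'} → Sub2 Δ Δ' → Form2 Δ → Form2 Δ'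
  sub2 σ ⊥ᶠ                 = ⊥ᶠ
  sub2 σ (app n (bound i) ts) = appV (σ i) (subTs σ ts)
  sub2 σ (app n (free X) ts)  = app n (free X) (subTs σ ts)
  sub2 σ (A ⇒ B)            = sub2 σ A ⇒ sub2 σ B
  sub2 σ (A ∧ B)            = sub2 σ A ∧ sub2 σ B
  sub2 σ (A ∨ B)            = sub2 σ A ∨ sub2 σ B
  sub2 σ (∀₁ A)             = ∀₁ (sub2 (lift2 σ) A)
  sub2 σ (∃₁ A)             = ∃₁ (sub2 (lift2 σ) A)
  sub2 σ (∀₂ n A)           = ∀₂ n (sub2 (lift2 σ) A)
  sub2 σ (∃₂ n A)           = ∃₂ n (sub2 (lift2 σ) A)

  open₁ : ∀ {Δ} → Form2 (fo ∷ Δ) → Term Δ → Form2 Δ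
  open₁ {Δ} A t = sub1 σ A
    where
      σ : Sub1 (fo ∷ Δ) Δ
      σ here      = t
      σ (there i) = idv1 i

  open₂ : ∀ {Δ n} → Form2 (so n ∷ Δ) → Val2 (so n) Δ → Form2 Δ
  open₂ {Δ} {n} A V = sub2 σ A
    where
      σ : Sub2 (so n ∷ Δ) Δ
      σ here      = V
      σ (there i) = idv2 i

  FO2 : ∀ {Δ} → ℕ → Form2 Δ → Set
  FO2 x ⊥ᶠ          = ⊥
  FO2 x (app n v ts) = FOTs x ts
  FO2 x (A ⇒ B)     = FO2 x A ⊎ FO2 x B
  FO2 x (A ∧ B)     = FO2 x A ⊎ FO2 x B
  FO2 x (A ∨ B)     = FO2 x A ⊎ FO2 x B
  FO2 x (∀₁ A)      = FO2 x A
  FO2 x (∃₁ A)      = FO2 x A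
  FO2 x (∀₂ n A)    = FO2 x A
  FO2 x (∃₂ n A)    = FO2 x A

  SO2 : ∀ {Δ} → ℕ → ℕ → Form2 Δ → Set
  SO2 n X ⊥ᶠ                   = ⊥
  SO2 n X (app m (bound i) ts) = ⊥
  SO2 n X (app m (free Y) ts)  = (m ≡ n) × (Y ≡ X)
  SO2 n X (A ⇒ B)             = SO2 n X A ⊎ SO2 n X B
  SO2 n X (A ∧ B)             = SO2 n X A ⊎ SO2 n X B
  SO2 n X (A ∨ B)             = SO2 n X A ⊎ SO2 n X B
  SO2 n X (∀₁ A)              = SO2 n X A
  SO2 n X (∃₁ A)              = SO2 n X A
  SO2 n X (∀₂ m A)            = SO2 n X A
  SO2 n X (∃₂ m A)            = SO2 n X A

  Closed2 : ∀ {Δ} → Form2 Δ → Set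
  Closed2 G = (∀ x → ¬ FO2 x G) × (∀ n X → ¬ SO2 n X G)

  Form2₀ : Set
  Form2₀ = Form2 []

  infix 3 _⊢₂[_]_
  data _⊢₂[_]_ : List Form2₀ → Logic → Form2₀ → Set where
    hyp  : ∀ {Γ k A} → A ∈ Γ → Γ ⊢₂[ k ] A
    ⊥E   : ∀ {Γ k A} → Γ ⊢₂[ k ] ⊥ᶠ → Γ ⊢₂[ k ] A
    raa  : ∀ {Γ A} → ((A ⇒ ⊥ᶠ) ∷ Γ) ⊢₂[ cla ] ⊥ᶠ → Γ ⊢₂[ cla ] A
    ⇒I   : ∀ {Γ k A B} → (A ∷ Γ) ⊢₂[ k ] B → Γ ⊢₂[ k ] A ⇒ B
    ⇒E   : ∀ {Γ k A B} → Γ ⊢₂[ k ] A ⇒ B → Γ ⊢₂[ k ] A → Γ ⊢₂[ k ] B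
    ∧I   : ∀ {Γ k A B} → Γ ⊢₂[ k ] A → Γ ⊢₂[ k ] B → Γ ⊢₂[ k ] A ∧ B
    ∧E₁  : ∀ {Γ k A B} → Γ ⊢₂[ k ] A ∧ B → Γ ⊢₂[ k ] A
    ∧E₂  : ∀ {Γ k A B} → Γ ⊢₂[ k ] A ∧ B → Γ ⊢₂[ k ] B
    ∨I₁  : ∀ {Γ k A B} → Γ ⊢₂[ k ] A → Γ ⊢₂[ k ] A ∨ B
    ∨I₂  : ∀ {Γ k A B} → Γ ⊢₂[ k ] B → Γ ⊢₂[ k ] A ∨ B
    ∨E   : ∀ {Γ k A B C} → Γ ⊢₂[ k ] A ∨ B → (A ∷ Γ) ⊢₂[ k ] C → (B ∷ Γ) ⊢₂[ k ] C
         → Γ ⊢₂[ k ] C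
    ∀₁I  : ∀ {Γ k A} (x : ℕ) → All (λ B → ¬ FO2 x B) Γ → ¬ FO2 x (∀₁ A)
         → Γ ⊢₂[ k ] open₁ A (fvar x) → Γ ⊢₂[ k ] ∀₁ A
    ∀₁E  : ∀ {Γ k A} (t : Term []) → Γ ⊢₂[ k ] ∀₁ A → Γ ⊢₂[ k ] open₁ A t
    ∃₁I  : ∀ {Γ k A} (t : Term []) → Γ ⊢₂[ k ] open₁ A t → Γ ⊢₂[ k ] ∃₁ A
    ∃₁E  : ∀ {Γ k A C} (x : ℕ) → All (λ B → ¬ FO2 x B) Γ → ¬ FO2 x (∃₁ A) → ¬ FO2 x C
         → Γ ⊢₂[ k ] ∃₁ A → (open₁ A (fvar x) ∷ Γ) ⊢₂[ k ] C → Γ ⊢₂[ k ] C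
    ∀₂I  : ∀ {Γ k n A} (Y : ℕ) → All (λ B → ¬ SO2 n Y B) Γ → ¬ SO2 n Y (∀₂ n A)
         → Γ ⊢₂[ k ] open₂ A (inj₁ (free Y)) → Γ ⊢₂[ k ] ∀₂ n A
    ∀₂E  : ∀ {Γ k n A} (G : Form2 (fos n ++ [])) → Γ ⊢₂[ k ] ∀₂ n A
         → Γ ⊢₂[ k ] open₂ A (inj₂ G)
    ∃₂I  : ∀ {Γ k n A} (G : Form2 (fos n ++ [])) → Γ ⊢₂[ k ] open₂ A (inj₂ G)
         → Γ ⊢₂[ k ] ∃₂ n A
    ∃₂E  : ∀ {Γ k n A C} (Y : ℕ) → All (λ B → ¬ SO2 n Y B) Γ → ¬ SO2 n Y (∃₂ n A)
         → ¬ SO2 n Y C → Γ ⊢₂[ k ] ∃₂ n A → (open₂ A (inj₁ (free Y)) ∷ Γ) ⊢₂[ k ] C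
         → Γ ⊢₂[ k ] C

  -- Γ ⊢²_k A for a (possibly infinite) set Γ of formulas:
  -- derivable from finitely many members of Γ
  Derivable2 : Logic → (Form2₀ → Set) → Form2₀ → Set
  Derivable2 k Γ A = Σ (List Form2₀) λ Δ → All Γ Δ × (Δ ⊢₂[ k ] A)

  data Form1 (Δ : Ctx) : Set where
    ⊥ᶠ      : Form1 Δ
    Ap      : (n : ℕ) → Term Δ → Vec (Term Δ) n → Form1 Δ
    _⇒_ _∧_ _∨_ : Form1 Δ → Form1 Δ → Form1 Δ
    ∀₁ ∃₁   : Form1 (fo ∷ Δ) → Form1 Δ

  liftT : ∀ {Δ Δ'} → (Δ ∋ fo → Term Δ') → ((fo ∷ Δ) ∋ fo → Term (fo ∷ Δ'))
  liftT σ here      = bvar here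
  liftT σ (there i) = renT there (σ i)

  subF1 : ∀ {Δ Δ'} → (Δ ∋ fo → Term Δ') → Form1 Δ → Form1 Δ'
  subF1 σ ⊥ᶠ          = ⊥ᶠ
  subF1 σ (Ap n t ts)  = Ap n (subT σ t) (subTs σ ts)
  subF1 σ (A ⇒ B)     = subF1 σ A ⇒ subF1 σ B
  subF1 σ (A ∧ B)     = subF1 σ A ∧ subF1 σ B
  subF1 σ (A ∨ B)     = subF1 σ A ∨ subF1 σ B
  subF1 σ (∀₁ A)      = ∀₁ (subF1 (liftT σ) A)
  subF1 σ (∃₁ A)      = ∃₁ (subF1 (liftT σ) A)

  open¹ : ∀ {Δ} → Form1 (fo ∷ Δ) → Term Δ → Form1 Δ
  open¹ {Δ} A t = subF1 σ A
    where
      σ : (fo ∷ Δ) ∋ fo → Term Δ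
      σ here      = t
      σ (there i) = bvar i

  FO1 : ∀ {Δ} → ℕ → Form1 Δ → Set
  FO1 x ⊥ᶠ         = ⊥
  FO1 x (Ap n t ts) = FOT x t ⊎ FOTs x ts
  FO1 x (A ⇒ B)    = FO1 x A ⊎ FO1 x B
  FO1 x (A ∧ B)    = FO1 x A ⊎ FO1 x B
  FO1 x (A ∨ B)    = FO1 x A ⊎ FO1 x B
  FO1 x (∀₁ A)     = FO1 x A
  FO1 x (∃₁ A)     = FO1 x A

  Form1₀ : Set
  Form1₀ = Form1 []

  infix 3 _⊢₁[_]_
  data _⊢₁[_]_ : List Form1₀ → Logic → Form1₀ → Set where
    hyp  : ∀ {Γ k A} → A ∈ Γ → Γ ⊢₁[ k ] A
    ⊥E   : ∀ {Γ k A} → Γ ⊢₁[ k ] ⊥ᶠ → Γ ⊢₁[ k ] A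
    raa  : ∀ {Γ A} → ((A ⇒ ⊥ᶠ) ∷ Γ) ⊢₁[ cla ] ⊥ᶠ → Γ ⊢₁[ cla ] A
    ⇒I   : ∀ {Γ k A B} → (A ∷ Γ) ⊢₁[ k ] B → Γ ⊢₁[ k ] A ⇒ B
    ⇒E   : ∀ {Γ k A B} → Γ ⊢₁[ k ] A ⇒ B → Γ ⊢₁[ k ] A → Γ ⊢₁[ k ] B
    ∧I   : ∀ {Γ k A B} → Γ ⊢₁[ k ] A → Γ ⊢₁[ k ] B → Γ ⊢₁[ k ] A ∧ B
    ∧E₁  : ∀ {Γ k A B} → Γ ⊢₁[ k ] A ∧ B → Γ ⊢₁[ k ] A
    ∧E₂  : ∀ {Γ k A B} → Γ ⊢₁[ k ] A ∧ B → Γ ⊢₁[ k ] B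
    ∨I₁  : ∀ {Γ k A B} → Γ ⊢₁[ k ] A → Γ ⊢₁[ k ] A ∨ B
    ∨I₂  : ∀ {Γ k A B} → Γ ⊢₁[ k ] B → Γ ⊢₁[ k ] A ∨ B
    ∨E   : ∀ {Γ k A B C} → Γ ⊢₁[ k ] A ∨ B → (A ∷ Γ) ⊢₁[ k ] C → (B ∷ Γ) ⊢₁[ k ] C
         → Γ ⊢₁[ k ] C
    ∀₁I  : ∀ {Γ k A} (x : ℕ) → All (λ B → ¬ FO1 x B) Γ → ¬ FO1 x (∀₁ A)
         → Γ ⊢₁[ k ] open¹ A (fvar x) → Γ ⊢₁[ k ] ∀₁ A
    ∀₁E  : ∀ {Γ k A} (t : Term []) → Γ ⊢₁[ k ] ∀₁ A → Γ ⊢₁[ k ] open¹ A t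
    ∃₁I  : ∀ {Γ k A} (t : Term []) → Γ ⊢₁[ k ] open¹ A t → Γ ⊢₁[ k ] ∃₁ A
    ∃₁E  : ∀ {Γ k A C} (x : ℕ) → All (λ B → ¬ FO1 x B) Γ → ¬ FO1 x (∃₁ A) → ¬ FO1 x C
         → Γ ⊢₁[ k ] ∃₁ A → (open¹ A (fvar x) ∷ Γ) ⊢₁[ k ] C → Γ ⊢₁[ k ] C

  Derivable1 : Logic → (Form1₀ → Set) → Form1₀ → Set
  Derivable1 k Γ A = Σ (List Form1₀) λ Δ → All Γ Δ × (Δ ⊢₁[ k ] A)

  -- ∀χ₁…∀χₘ F  (χ's of the kinds listed in K, innermost first)
  allQ : (K : Ctx) → Form2 K → Form2₀
  allQ []         F = F
  allQ (fo ∷ K)   F = allQ K (∀₁ F)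
  allQ (so n ∷ K) F = allQ K (∀₂ n F)

  -- ∀x₁…∀xₙ F   (x₁ outermost)
  allFO : ∀ {Δ} (n : ℕ) → Form2 (fos n ++ Δ) → Form2 Δ
  allFO zero    F = F
  allFO (suc n) F = allFO n (∀₁ F)

  -- the terms x₁,…,xₙ under the binders ∀x₁…∀xₙ
  xs : ∀ {Δ} (n : ℕ) → Vec (Term (fos n ++ Δ)) n
  xs zero    = []
  xs (suc n) = subTs (bvar ∘ there) (xs n) ∷ʳ bvar here

  -- ∀χ⃗ ∃Xⁿ ∀x₁…∀xₙ (G ↔ Xⁿ(x₁,…,xₙ)),  G with free variables among x⃗, χ⃗
  -- (hence not containing X)
  comp : (K : Ctx) (n : ℕ) → Form2 (fos n ++ K) → Form2₀
  comp K n G =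
    allQ K (∃₂ n (allFO n (renF2 (liftN n there) G ⇔ app n (bound (wkFos n here)) (xs n))))

  SC2 : Form2₀ → Set
  SC2 F = Σ Ctx λ K → Σ ℕ λ n → Σ (Form2 (fos n ++ K)) λ G → Closed2 G × (F ≡ comp K n G)

  module _ (φ : (n : ℕ) → ℕ ⤖ ℕ) where

    code : ∀ {Δ} → Form2 Δ → Form1 ⌜ Δ ⌝
    code ⊥ᶠ                   = ⊥ᶠ
    code (app n (bound i) ts) = Ap n (bvar (cv i)) (subTs (bvar ∘ cv) ts)
    code (app n (free X) ts)  = Ap n (fvar (Bijection.to (φ n) X)) (subTs (bvar ∘ cv) ts)
    code (A ⇒ B)             = code A ⇒ code B
    code (A ∧ B)             = code A ∧ code B
    code (A ∨ B)             = code A ∨ code B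
    code (∀₁ A)              = ∀₁ (code A)
    code (∃₁ A)              = ∃₁ (code A)
    code (∀₂ n A)            = ∀₁ (code A)
    code (∃₂ n A)            = ∃₁ (code A)

    star : (Form2₀ → Set) → Form1₀ → Set
    star Γ F₁ = Σ Form2₀ λ F → Γ F × (F₁ ≡ code F)

    SC1 : Form1₀ → Set
    SC1 = star SC2

module Submission where

-- A first-order derivation of A* from Γ* and SC₁ is decoded back into second-order logic.
-- Fix N above every arity occurring in A and in the hypotheses used. The decoding of an
-- L₁-formula replaces a quantifier Qy by the block Qy QYᴺ … QY⁰, one second-order variable of
-- each arity n ≤ N, and an atom Apₙ(y, t⃗) by Yⁿ(t⃗); a free name z in head position becomes
-- the second-order variable φₙ⁻¹(z), while compound head terms and arities above N give ⊥.
-- Every first-order rule becomes a derived second-order rule, because the blocks can be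
-- instantiated by the abstractions λx⃗.Z(x⃗) and λx⃗.⊥, which commute with decoding. The
-- decoding of F* is provably equivalent to F (the extra quantifiers are vacuous), and the
-- members of SC₂ are derivable with witness λx⃗.G, so the decoded derivation yields A from Γ.

open import Defs
open import Data.Nat using (ℕ; zero; suc; _+_; _≤_; _<_; z≤n; _≤?_)
open import Data.Nat.Properties using (≤-refl; ≤-trans; _≟_; <⇒≱; m≤m+n; m≤n+m; m≤n⇒m≤n+o; m≤n⇒m≤o+n; n≤1+n; m≤n⇒m<n∨m≡n; ≤-pred)
open import Data.Fin using (Fin; zero; suc; opposite; fromℕ; inject₁)
open import Data.Fin.Properties using (opposite-involutive)
open import Data.List using (List; []; _∷_; _++_; map)
open import Data.List.Relation.Unary.All using (All; []; _∷_; tabulate) renaming (lookup to All-lookup)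
open import Data.List.Relation.Unary.AllPairs using ([]; _∷_)
open import Data.List.Relation.Unary.Unique.Propositional using (Unique)
open import Data.List.Relation.Unary.All.Properties using (++⁺; map⁺)
open import Data.List.Membership.Propositional using (_∈_)
open import Data.List.Membership.Propositional.Properties using (∈-map⁺; ∈-++⁺ˡ)
open import Data.List.Relation.Unary.Any using (here; there)
open import Data.Vec using (Vec; []; _∷_; lookup; _∷ʳ_)
open import Data.Product using (Σ; _×_; _,_; proj₁; proj₂)
open import Data.Sum using (_⊎_; inj₁; inj₂; map₁; map₂)
open import Data.Empty using (⊥-elim)
open import Data.Unit using (⊤; tt)
open import Relation.Nullary using (¬_; Dec; yes; no)
open import Relation.Binary.PropositionalEquality using (_≡_; refl; sym; trans; cong; cong₂; subst)
open import Function using (_∘_; id)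
open import Function.Bundles using (_⤖_; Bijection)

module Naming (φ : (n : ℕ) → ℕ ⤖ ℕ) where

  to : ℕ → ℕ → ℕ
  to n X = Bijection.to (φ n) X

  from : ℕ → ℕ → ℕ
  from n z = proj₁ (Bijection.strictlySurjective (φ n) z)

  to-from : ∀ n z → to n (from n z) ≡ z
  to-from n z = proj₂ (Bijection.strictlySurjective (φ n) z)

  from-to : ∀ n X → from n (to n X) ≡ X
  from-to n X = Bijection.injective (φ n) (to-from n (to n X))

module Syntax (S : Signature) where

  Tm = Term S
  F2 = Form2 S
  SV = SVar S

  mutual
    subT-ext : ∀ {Δ Δ'} {σ τ : Δ ∋ fo → Tm Δ'} → (∀ i → σ i ≡ τ i) → (t : Tm Δ) → subT S σ t ≡ subT S τ t
    subT-ext e (bvar i) = e i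
    subT-ext e (fvar x) = refl
    subT-ext e (fun f ts) = cong (fun f) (subTs-ext e ts)

    subTs-ext : ∀ {Δ Δ' n} {σ τ : Δ ∋ fo → Tm Δ'} → (∀ i → σ i ≡ τ i) → (ts : Vec (Tm Δ) n) → subTs S σ ts ≡ subTs S τ ts
    subTs-ext e [] = refl
    subTs-ext e (t ∷ ts) = cong₂ _∷_ (subT-ext e t) (subTs-ext e ts)

  mutual
    subT-fuse : ∀ {Δ Δ' Δ''} (σ : Δ' ∋ fo → Tm Δ'') (τ : Δ ∋ fo → Tm Δ') (t : Tm Δ)
              → subT S σ (subT S τ t) ≡ subT S (subT S σ ∘ τ) t
    subT-fuse σ τ (bvar i) = refl
    subT-fuse σ τ (fvar x) = refl
    subT-fuse σ τ (fun f ts) = cong (fun f) (subTs-fuse σ τ ts)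

    subTs-fuse : ∀ {Δ Δ' Δ'' n} (σ : Δ' ∋ fo → Tm Δ'') (τ : Δ ∋ fo → Tm Δ') (ts : Vec (Tm Δ) n)
              → subTs S σ (subTs S τ ts) ≡ subTs S (subT S σ ∘ τ) ts
    subTs-fuse σ τ [] = refl
    subTs-fuse σ τ (t ∷ ts) = cong₂ _∷_ (subT-fuse σ τ t) (subTs-fuse σ τ ts)

  mutual
    subT-id : ∀ {Δ} {σ : Δ ∋ fo → Tm Δ} → (∀ i → σ i ≡ bvar i) → (t : Tm Δ) → subT S σ t ≡ t
    subT-id e (bvar i) = e i
    subT-id e (fvar x) = refl
    subT-id e (fun f ts) = cong (fun f) (subTs-id e ts)

    subTs-id : ∀ {Δ n} {σ : Δ ∋ fo → Tm Δ} → (∀ i → σ i ≡ bvar i) → (ts : Vec (Tm Δ) n) → subTs S σ ts ≡ ts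
    subTs-id e [] = refl
    subTs-id e (t ∷ ts) = cong₂ _∷_ (subT-id e t) (subTs-id e ts)

  subT-wk : ∀ {Δ Δ' k} (σ : Δ ∋ fo → Tm Δ') (τ : (k ∷ Δ) ∋ fo → Tm (k ∷ Δ')) → (∀ i → τ (there i) ≡ renT S there (σ i))
         → (t : Tm Δ) → subT S τ (renT S there t) ≡ renT S there (subT S σ t)
  subT-wk σ τ e t = trans (subT-fuse τ _ t) (trans (subT-ext (λ i → e i) t) (sym (subT-fuse _ σ t)))

  subTs-wk : ∀ {Δ Δ' k n} (σ : Δ ∋ fo → Tm Δ') (τ : (k ∷ Δ) ∋ fo → Tm (k ∷ Δ')) → (∀ i → τ (there i) ≡ renT S there (σ i))
         → (ts : Vec (Tm Δ) n) → subTs S τ (subTs S (bvar ∘ there) ts) ≡ subTs S (bvar ∘ there) (subTs S σ ts)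
  subTs-wk σ τ e ts = trans (subTs-fuse τ _ ts) (trans (subTs-ext (λ i → e i) ts) (sym (subTs-fuse _ σ ts)))

  lift1-ext : ∀ {Δ Δ' k'} {σ τ : Sub1 S Δ Δ'} → (∀ {k} (i : Δ ∋ k) → σ i ≡ τ i) → ∀ {k} (i : (k' ∷ Δ) ∋ k) → lift1 S σ i ≡ lift1 S τ i
  lift1-ext e here = refl
  lift1-ext e (there i) = cong (wkV1 S) (e i)

  sub1-ext : ∀ {Δ Δ'} {σ τ : Sub1 S Δ Δ'} → (∀ {k} (i : Δ ∋ k) → σ i ≡ τ i) → (A : F2 Δ) → sub1 S σ A ≡ sub1 S τ A
  sub1-ext e ⊥ᶠ = refl
  sub1-ext e (app n (bound i) ts) = cong₂ (app n) (e i) (subTs-ext (λ i → e i) ts)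
  sub1-ext e (app n (free X) ts) = cong (app n (free X)) (subTs-ext (λ i → e i) ts)
  sub1-ext e (A ⇒ B) = cong₂ _⇒_ (sub1-ext e A) (sub1-ext e B)
  sub1-ext e (A ∧ B) = cong₂ _∧_ (sub1-ext e A) (sub1-ext e B)
  sub1-ext e (A ∨ B) = cong₂ _∨_ (sub1-ext e A) (sub1-ext e B)
  sub1-ext e (∀₁ A) = cong ∀₁ (sub1-ext (lift1-ext e) A)
  sub1-ext e (∃₁ A) = cong ∃₁ (sub1-ext (lift1-ext e) A)
  sub1-ext e (∀₂ n A) = cong (∀₂ n) (sub1-ext (lift1-ext e) A)
  sub1-ext e (∃₂ n A) = cong (∃₂ n) (sub1-ext (lift1-ext e) A)

  subSV : ∀ {Δ Δ' n} → Sub1 S Δ Δ' → SV Δ n → SV Δ' n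
  subSV σ (bound i) = σ i
  subSV σ (free X) = free X

  sub1-app : ∀ {Δ Δ' n} (σ : Sub1 S Δ Δ') (v : SV Δ n) (ts : Vec (Tm Δ) n)
           → sub1 S σ (app n v ts) ≡ app n (subSV σ v) (subTs S σ ts)
  sub1-app σ (bound i) ts = refl
  sub1-app σ (free X) ts = refl

  _∘₁_ : ∀ {Δ Δ' Δ''} → Sub1 S Δ' Δ'' → Sub1 S Δ Δ' → Sub1 S Δ Δ''
  (σ ∘₁ τ) {fo} i = subT S σ (τ i)
  (σ ∘₁ τ) {so n} i = subSV σ (τ i)

  lift1-∘ : ∀ {Δ Δ' Δ'' k'} (σ : Sub1 S Δ' Δ'') (τ : Sub1 S Δ Δ') → ∀ {k} (i : (k' ∷ Δ) ∋ k)
          → (lift1 S σ ∘₁ lift1 S τ) i ≡ lift1 S (σ ∘₁ τ) i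
  lift1-∘ σ τ {fo} here = refl
  lift1-∘ σ τ {so n} here = refl
  lift1-∘ σ τ {fo} (there i) = subT-wk σ (lift1 S σ) (λ _ → refl) (τ i)
  lift1-∘ σ τ {so n} (there i) with τ i
  ... | bound j = refl
  ... | free X = refl

  sub1-fuse : ∀ {Δ Δ' Δ''} (σ : Sub1 S Δ' Δ'') (τ : Sub1 S Δ Δ') (A : F2 Δ) → sub1 S σ (sub1 S τ A) ≡ sub1 S (σ ∘₁ τ) A
  sub1-fuse σ τ ⊥ᶠ = refl
  sub1-fuse σ τ (app n (bound i) ts) = trans (sub1-app σ (τ i) _) (cong (app n _) (subTs-fuse σ τ ts))
  sub1-fuse σ τ (app n (free X) ts) = cong (app n (free X)) (subTs-fuse σ τ ts)
  sub1-fuse σ τ (A ⇒ B) = cong₂ _⇒_ (sub1-fuse σ τ A) (sub1-fuse σ τ B)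
  sub1-fuse σ τ (A ∧ B) = cong₂ _∧_ (sub1-fuse σ τ A) (sub1-fuse σ τ B)
  sub1-fuse σ τ (A ∨ B) = cong₂ _∨_ (sub1-fuse σ τ A) (sub1-fuse σ τ B)
  sub1-fuse σ τ (∀₁ A) = cong ∀₁ (trans (sub1-fuse _ _ A) (sub1-ext (lift1-∘ σ τ) A))
  sub1-fuse σ τ (∃₁ A) = cong ∃₁ (trans (sub1-fuse _ _ A) (sub1-ext (lift1-∘ σ τ) A))
  sub1-fuse σ τ (∀₂ n A) = cong (∀₂ n) (trans (sub1-fuse _ _ A) (sub1-ext (lift1-∘ σ τ) A))
  sub1-fuse σ τ (∃₂ n A) = cong (∃₂ n) (trans (sub1-fuse _ _ A) (sub1-ext (lift1-∘ σ τ) A))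

  lift1-id : ∀ {Δ k'} {σ : Sub1 S Δ Δ} → (∀ {k} (i : Δ ∋ k) → σ i ≡ idv1 S i) → ∀ {k} (i : (k' ∷ Δ) ∋ k) → lift1 S σ i ≡ idv1 S i
  lift1-id e {fo} here = refl
  lift1-id e {so n} here = refl
  lift1-id e {fo} (there i) = cong (wkV1 S) (e i)
  lift1-id e {so n} (there i) = cong (wkV1 S) (e i)

  sub1-id : ∀ {Δ} {σ : Sub1 S Δ Δ} → (∀ {k} (i : Δ ∋ k) → σ i ≡ idv1 S i) → (A : F2 Δ) → sub1 S σ A ≡ A
  sub1-id e ⊥ᶠ = refl
  sub1-id e (app n (bound i) ts) = cong₂ (app n) (e i) (subTs-id (λ i → e i) ts)
  sub1-id e (app n (free X) ts) = cong (app n (free X)) (subTs-id (λ i → e i) ts)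
  sub1-id e (A ⇒ B) = cong₂ _⇒_ (sub1-id e A) (sub1-id e B)
  sub1-id e (A ∧ B) = cong₂ _∧_ (sub1-id e A) (sub1-id e B)
  sub1-id e (A ∨ B) = cong₂ _∨_ (sub1-id e A) (sub1-id e B)
  sub1-id e (∀₁ A) = cong ∀₁ (sub1-id (lift1-id e) A)
  sub1-id e (∃₁ A) = cong ∃₁ (sub1-id (lift1-id e) A)
  sub1-id e (∀₂ n A) = cong (∀₂ n) (sub1-id (lift1-id e) A)
  sub1-id e (∃₂ n A) = cong (∃₂ n) (sub1-id (lift1-id e) A)

  boundArgs : ∀ {Δ} (n : ℕ) → Vec (Tm (fos n ++ Δ)) n
  boundArgs zero = []
  boundArgs (suc n) = bvar here ∷ subTs S (bvar ∘ there) (boundArgs n)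

  boundArgs-inst : ∀ {Δ n} (us : Vec (Tm Δ) n) → subTs S (inst S us) (boundArgs n) ≡ us
  boundArgs-inst [] = refl
  boundArgs-inst (u ∷ us) = cong (u ∷_) (trans (subTs-fuse _ _ (boundArgs _)) (boundArgs-inst us))

  boundArgs-ren : ∀ {Δ Δ'} n (ρ : Ren Δ Δ') → subTs S (bvar ∘ liftN n ρ) (boundArgs n) ≡ boundArgs n
  boundArgs-ren zero ρ = refl
  boundArgs-ren (suc n) ρ = cong (bvar here ∷_) (trans (subTs-fuse _ _ (boundArgs n))
                        (trans (sym (subTs-fuse _ _ (boundArgs n))) (cong (subTs S (bvar ∘ there)) (boundArgs-ren n ρ))))

  varAbs : ∀ {Δ} (n : ℕ) → ℕ → F2 (fos n ++ Δ)
  varAbs n Z = app n (free Z) (boundArgs n)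

  wkV2-varAbs : ∀ {Δ k n} Z → wkV2 S {Δ} {so n} {k} (inj₂ (varAbs n Z)) ≡ inj₂ (varAbs n Z)
  wkV2-varAbs {n = n} Z = cong (λ us → inj₂ (app n (free Z) us)) (boundArgs-ren n there)

  appV-varAbs : ∀ {Δ n} Z (us : Vec (Tm Δ) n) → appV S (inj₂ (varAbs n Z)) us ≡ app n (free Z) us
  appV-varAbs {n = n} Z us = cong (app n (free Z)) (boundArgs-inst us)

  Agrees : ∀ k {Δ'} → Val2 S k Δ' → Val1 S k Δ' → Set
  Agrees fo t t' = t ≡ t'
  Agrees (so n) v v' = (v ≡ inj₁ v') ⊎ Σ ℕ (λ Z → (v ≡ inj₂ (varAbs n Z)) × (v' ≡ free Z))

  lift-agrees : ∀ {Δ Δ' k'} {σ : Sub2 S Δ Δ'} {τ : Sub1 S Δ Δ'} → (∀ {k} (i : Δ ∋ k) → Agrees k (σ i) (τ i))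
         → ∀ {k} (i : (k' ∷ Δ) ∋ k) → Agrees k (lift2 S σ i) (lift1 S τ i)
  lift-agrees e {fo} here = refl
  lift-agrees e {so n} here = inj₁ refl
  lift-agrees e {fo} (there i) = cong (renT S there) (e i)
  lift-agrees e {so n} (there i) with e i
  ... | inj₁ p = inj₁ (cong (wkV2 S) p)
  ... | inj₂ (Z , p , q) = inj₂ (Z , trans (cong (wkV2 S) p) (wkV2-varAbs Z) , cong (renSV S there) q)

  sub2-sub1 : ∀ {Δ Δ'} {σ : Sub2 S Δ Δ'} {τ : Sub1 S Δ Δ'} → (∀ {k} (i : Δ ∋ k) → Agrees k (σ i) (τ i))
            → (X : F2 Δ) → sub2 S σ X ≡ sub1 S τ X
  sub2-sub1 e ⊥ᶠ = refl
  sub2-sub1 {τ = τ} e (app n (bound i) ts) with e i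
  ... | inj₁ p = trans (cong₂ (appV S) p refl) (cong (app n (τ i)) (subTs-ext (λ i → e i) ts))
  ... | inj₂ (Z , p , q) = trans (cong₂ (appV S) p refl) (trans (appV-varAbs Z _)
                             (cong₂ (app n) (sym q) (subTs-ext (λ i → e i) ts)))
  sub2-sub1 e (app n (free X) ts) = cong (app n (free X)) (subTs-ext (λ i → e i) ts)
  sub2-sub1 e (X ⇒ Y) = cong₂ _⇒_ (sub2-sub1 e X) (sub2-sub1 e Y)
  sub2-sub1 e (X ∧ Y) = cong₂ _∧_ (sub2-sub1 e X) (sub2-sub1 e Y)
  sub2-sub1 e (X ∨ Y) = cong₂ _∨_ (sub2-sub1 e X) (sub2-sub1 e Y)
  sub2-sub1 e (∀₁ X) = cong ∀₁ (sub2-sub1 (lift-agrees e) X)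
  sub2-sub1 e (∃₁ X) = cong ∃₁ (sub2-sub1 (lift-agrees e) X)
  sub2-sub1 e (∀₂ n X) = cong (∀₂ n) (sub2-sub1 (lift-agrees e) X)
  sub2-sub1 e (∃₂ n X) = cong (∃₂ n) (sub2-sub1 (lift-agrees e) X)

  idv1-liftR : ∀ {Δ Δ' k'} (ρ : Ren Δ Δ') → ∀ {k} (i : (k' ∷ Δ) ∋ k) → idv1 S (liftR ρ i) ≡ lift1 S (λ j → idv1 S (ρ j)) i
  idv1-liftR ρ {fo} here = refl
  idv1-liftR ρ {so n} here = refl
  idv1-liftR ρ {fo} (there i) = refl
  idv1-liftR ρ {so n} (there i) = refl

  renF2-sub1 : ∀ {Δ Δ'} (ρ : Ren Δ Δ') (A : F2 Δ) → renF2 S ρ A ≡ sub1 S (λ i → idv1 S (ρ i)) A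
  renF2-sub1 ρ ⊥ᶠ = refl
  renF2-sub1 ρ (app n (bound i) ts) = refl
  renF2-sub1 ρ (app n (free X) ts) = refl
  renF2-sub1 ρ (A ⇒ B) = cong₂ _⇒_ (renF2-sub1 ρ A) (renF2-sub1 ρ B)
  renF2-sub1 ρ (A ∧ B) = cong₂ _∧_ (renF2-sub1 ρ A) (renF2-sub1 ρ B)
  renF2-sub1 ρ (A ∨ B) = cong₂ _∨_ (renF2-sub1 ρ A) (renF2-sub1 ρ B)
  renF2-sub1 ρ (∀₁ A) = cong ∀₁ (trans (renF2-sub1 _ A) (sub1-ext (idv1-liftR ρ) A))
  renF2-sub1 ρ (∃₁ A) = cong ∃₁ (trans (renF2-sub1 _ A) (sub1-ext (idv1-liftR ρ) A))
  renF2-sub1 ρ (∀₂ m A) = cong (∀₂ m) (trans (renF2-sub1 _ A) (sub1-ext (idv1-liftR ρ) A))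
  renF2-sub1 ρ (∃₂ m A) = cong (∃₂ m) (trans (renF2-sub1 _ A) (sub1-ext (idv1-liftR ρ) A))

  mutual
    FOT-sub : ∀ {Δ Δ'} x (σ : Δ ∋ fo → Tm Δ') (t : Tm Δ) → FOT S x (subT S σ t) → FOT S x t ⊎ Σ (Δ ∋ fo) (λ i → FOT S x (σ i))
    FOT-sub x σ (bvar i) o = inj₂ (i , o)
    FOT-sub x σ (fvar y) o = inj₁ o
    FOT-sub x σ (fun f ts) o = FOTs-sub x σ ts o

    FOTs-sub : ∀ {Δ Δ' n} x (σ : Δ ∋ fo → Tm Δ') (ts : Vec (Tm Δ) n) → FOTs S x (subTs S σ ts) → FOTs S x ts ⊎ Σ (Δ ∋ fo) (λ i → FOT S x (σ i))
    FOTs-sub x σ [] ()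
    FOTs-sub x σ (t ∷ ts) (inj₁ o) = map₁ inj₁ (FOT-sub x σ t o)
    FOTs-sub x σ (t ∷ ts) (inj₂ o) = map₁ inj₂ (FOTs-sub x σ ts o)

  FOT-wk : ∀ {Δ k} x (t : Tm Δ) → FOT S x (renT S (there {k' = k}) t) → FOT S x t
  FOT-wk x t o with FOT-sub x _ t o
  ... | inj₁ p = p
  ... | inj₂ (i , ())

  FO-lift : ∀ {Δ Δ' k'} x (σ : Sub1 S Δ Δ') → Σ ((k' ∷ Δ) ∋ fo) (λ i → FOT S x (lift1 S σ i)) → Σ (Δ ∋ fo) (λ i → FOT S x (σ i))
  FO-lift x σ (here , ())
  FO-lift x σ (there i , o) = i , FOT-wk x (σ i) o

  FO2-sub1 : ∀ {Δ Δ'} x (σ : Sub1 S Δ Δ') (A : F2 Δ) → FO2 S x (sub1 S σ A) → FO2 S x A ⊎ Σ (Δ ∋ fo) (λ i → FOT S x (σ i))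
  FO2-sub1 x σ ⊥ᶠ ()
  FO2-sub1 x σ (app n (bound i) ts) o = FOTs-sub x σ ts o
  FO2-sub1 x σ (app n (free X) ts) o = FOTs-sub x σ ts o
  FO2-sub1 x σ (A ⇒ B) (inj₁ o) = map₁ inj₁ (FO2-sub1 x σ A o)
  FO2-sub1 x σ (A ⇒ B) (inj₂ o) = map₁ inj₂ (FO2-sub1 x σ B o)
  FO2-sub1 x σ (A ∧ B) (inj₁ o) = map₁ inj₁ (FO2-sub1 x σ A o)
  FO2-sub1 x σ (A ∧ B) (inj₂ o) = map₁ inj₂ (FO2-sub1 x σ B o)
  FO2-sub1 x σ (A ∨ B) (inj₁ o) = map₁ inj₁ (FO2-sub1 x σ A o)
  FO2-sub1 x σ (A ∨ B) (inj₂ o) = map₁ inj₂ (FO2-sub1 x σ B o)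
  FO2-sub1 x σ (∀₁ A) o = map₂ (FO-lift x σ) (FO2-sub1 x (lift1 S σ) A o)
  FO2-sub1 x σ (∃₁ A) o = map₂ (FO-lift x σ) (FO2-sub1 x (lift1 S σ) A o)
  FO2-sub1 x σ (∀₂ n A) o = map₂ (FO-lift x σ) (FO2-sub1 x (lift1 S σ) A o)
  FO2-sub1 x σ (∃₂ n A) o = map₂ (FO-lift x σ) (FO2-sub1 x (lift1 S σ) A o)

  SO-lift : ∀ {Δ Δ' k'} m X (σ : Sub1 S Δ Δ') → Σ ((k' ∷ Δ) ∋ so m) (λ i → lift1 S σ i ≡ free X) → Σ (Δ ∋ so m) (λ i → σ i ≡ free X)
  SO-lift m X σ (here , ())
  SO-lift m X σ (there i , e) with σ i in eq
  SO-lift m X σ (there i , ()) | bound j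
  SO-lift m X σ (there i , refl) | free Y = i , eq

  SO2-sub1 : ∀ {Δ Δ'} m X (σ : Sub1 S Δ Δ') (A : F2 Δ) → SO2 S m X (sub1 S σ A) → SO2 S m X A ⊎ Σ (Δ ∋ so m) (λ i → σ i ≡ free X)
  SO2-sub1 m X σ ⊥ᶠ ()
  SO2-sub1 m X σ (app n (bound i) ts) o with σ i in eq
  SO2-sub1 m X σ (app n (bound i) ts) () | bound j
  SO2-sub1 m X σ (app n (bound i) ts) (refl , refl) | free Y = inj₂ (i , eq)
  SO2-sub1 m X σ (app n (free Y) ts) o = inj₁ o
  SO2-sub1 m X σ (A ⇒ B) (inj₁ o) = map₁ inj₁ (SO2-sub1 m X σ A o)
  SO2-sub1 m X σ (A ⇒ B) (inj₂ o) = map₁ inj₂ (SO2-sub1 m X σ B o)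
  SO2-sub1 m X σ (A ∧ B) (inj₁ o) = map₁ inj₁ (SO2-sub1 m X σ A o)
  SO2-sub1 m X σ (A ∧ B) (inj₂ o) = map₁ inj₂ (SO2-sub1 m X σ B o)
  SO2-sub1 m X σ (A ∨ B) (inj₁ o) = map₁ inj₁ (SO2-sub1 m X σ A o)
  SO2-sub1 m X σ (A ∨ B) (inj₂ o) = map₁ inj₂ (SO2-sub1 m X σ B o)
  SO2-sub1 m X σ (∀₁ A) o = map₂ (SO-lift m X σ) (SO2-sub1 m X (lift1 S σ) A o)
  SO2-sub1 m X σ (∃₁ A) o = map₂ (SO-lift m X σ) (SO2-sub1 m X (lift1 S σ) A o)
  SO2-sub1 m X σ (∀₂ n A) o = map₂ (SO-lift m X σ) (SO2-sub1 m X (lift1 S σ) A o)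
  SO2-sub1 m X σ (∃₂ n A) o = map₂ (SO-lift m X σ) (SO2-sub1 m X (lift1 S σ) A o)

  mutual
    nameBoundT : ∀ {Δ} → Tm Δ → ℕ
    nameBoundT (bvar i) = 0
    nameBoundT (fvar x) = suc x
    nameBoundT (fun f ts) = nameBoundTs ts

    nameBoundTs : ∀ {Δ n} → Vec (Tm Δ) n → ℕ
    nameBoundTs [] = 0
    nameBoundTs (t ∷ ts) = nameBoundT t + nameBoundTs ts

  mutual
    FOT-nameBound : ∀ {Δ} x (t : Tm Δ) → FOT S x t → x < nameBoundT t
    FOT-nameBound x (bvar i) ()
    FOT-nameBound x (fvar y) refl = ≤-refl
    FOT-nameBound x (fun f ts) o = FOTs-nameBound x ts o

    FOTs-nameBound : ∀ {Δ n} x (ts : Vec (Tm Δ) n) → FOTs S x ts → x < nameBoundTs ts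
    FOTs-nameBound x [] ()
    FOTs-nameBound x (t ∷ ts) (inj₁ o) = m≤n⇒m≤n+o (nameBoundTs ts) (FOT-nameBound x t o)
    FOTs-nameBound x (t ∷ ts) (inj₂ o) = m≤n⇒m≤o+n (nameBoundT t) (FOTs-nameBound x ts o)

  -- One bound serves first- and second-order names alike, so a single fresh number is both.
  nameBound : ∀ {Δ} → F2 Δ → ℕ
  nameBound ⊥ᶠ = 0
  nameBound (app n (bound i) ts) = nameBoundTs ts
  nameBound (app n (free X) ts) = suc X + nameBoundTs ts
  nameBound (A ⇒ B) = nameBound A + nameBound B
  nameBound (A ∧ B) = nameBound A + nameBound B
  nameBound (A ∨ B) = nameBound A + nameBound B
  nameBound (∀₁ A) = nameBound A
  nameBound (∃₁ A) = nameBound A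
  nameBound (∀₂ n A) = nameBound A
  nameBound (∃₂ n A) = nameBound A

  FO2-nameBound : ∀ {Δ} x (A : F2 Δ) → FO2 S x A → x < nameBound A
  FO2-nameBound x ⊥ᶠ ()
  FO2-nameBound x (app n (bound i) ts) o = FOTs-nameBound x ts o
  FO2-nameBound x (app n (free X) ts) o = m≤n⇒m≤o+n (suc X) (FOTs-nameBound x ts o)
  FO2-nameBound x (A ⇒ B) (inj₁ o) = m≤n⇒m≤n+o (nameBound B) (FO2-nameBound x A o)
  FO2-nameBound x (A ⇒ B) (inj₂ o) = m≤n⇒m≤o+n (nameBound A) (FO2-nameBound x B o)
  FO2-nameBound x (A ∧ B) (inj₁ o) = m≤n⇒m≤n+o (nameBound B) (FO2-nameBound x A o)
  FO2-nameBound x (A ∧ B) (inj₂ o) = m≤n⇒m≤o+n (nameBound A) (FO2-nameBound x B o)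
  FO2-nameBound x (A ∨ B) (inj₁ o) = m≤n⇒m≤n+o (nameBound B) (FO2-nameBound x A o)
  FO2-nameBound x (A ∨ B) (inj₂ o) = m≤n⇒m≤o+n (nameBound A) (FO2-nameBound x B o)
  FO2-nameBound x (∀₁ A) o = FO2-nameBound x A o
  FO2-nameBound x (∃₁ A) o = FO2-nameBound x A o
  FO2-nameBound x (∀₂ n A) o = FO2-nameBound x A o
  FO2-nameBound x (∃₂ n A) o = FO2-nameBound x A o

  SO2-nameBound : ∀ {Δ} m X (A : F2 Δ) → SO2 S m X A → X < nameBound A
  SO2-nameBound m X ⊥ᶠ ()
  SO2-nameBound m X (app n (bound i) ts) ()
  SO2-nameBound m X (app n (free Y) ts) (refl , refl) = m≤n⇒m≤n+o (nameBoundTs ts) ≤-refl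
  SO2-nameBound m X (A ⇒ B) (inj₁ o) = m≤n⇒m≤n+o (nameBound B) (SO2-nameBound m X A o)
  SO2-nameBound m X (A ⇒ B) (inj₂ o) = m≤n⇒m≤o+n (nameBound A) (SO2-nameBound m X B o)
  SO2-nameBound m X (A ∧ B) (inj₁ o) = m≤n⇒m≤n+o (nameBound B) (SO2-nameBound m X A o)
  SO2-nameBound m X (A ∧ B) (inj₂ o) = m≤n⇒m≤o+n (nameBound A) (SO2-nameBound m X B o)
  SO2-nameBound m X (A ∨ B) (inj₁ o) = m≤n⇒m≤n+o (nameBound B) (SO2-nameBound m X A o)
  SO2-nameBound m X (A ∨ B) (inj₂ o) = m≤n⇒m≤o+n (nameBound A) (SO2-nameBound m X B o)
  SO2-nameBound m X (∀₁ A) o = SO2-nameBound m X A o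
  SO2-nameBound m X (∃₁ A) o = SO2-nameBound m X A o
  SO2-nameBound m X (∀₂ n A) o = SO2-nameBound m X A o
  SO2-nameBound m X (∃₂ n A) o = SO2-nameBound m X A o

  nameBoundL : ∀ {Δ} → List (F2 Δ) → ℕ
  nameBoundL [] = 0
  nameBoundL (A ∷ Γ) = nameBound A + nameBoundL Γ

  freshFO : ∀ {Δ} (Γ : List (F2 Δ)) y → nameBoundL Γ ≤ y → All (λ B → ¬ FO2 S y B) Γ
  freshFO [] y p = []
  freshFO (A ∷ Γ) y p = (λ o → <⇒≱ (m≤n⇒m≤n+o (nameBoundL Γ) (FO2-nameBound y A o)) p) ∷ freshFO Γ y (≤-trans (m≤n+m (nameBoundL Γ) (nameBound A)) p)

  freshSO : ∀ {Δ} (Γ : List (F2 Δ)) m y → nameBoundL Γ ≤ y → All (λ B → ¬ SO2 S m y B) Γ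
  freshSO [] m y p = []
  freshSO (A ∷ Γ) m y p = (λ o → <⇒≱ (m≤n⇒m≤n+o (nameBoundL Γ) (SO2-nameBound m y A o)) p) ∷ freshSO Γ m y (≤-trans (m≤n+m (nameBoundL Γ) (nameBound A)) p)

  lift2-ext : ∀ {Δ Δ' k'} {σ τ : Sub2 S Δ Δ'} → (∀ {k} (i : Δ ∋ k) → σ i ≡ τ i) → ∀ {k} (i : (k' ∷ Δ) ∋ k) → lift2 S σ i ≡ lift2 S τ i
  lift2-ext e here = refl
  lift2-ext e (there i) = cong (wkV2 S) (e i)

  sub2-ext : ∀ {Δ Δ'} {σ τ : Sub2 S Δ Δ'} → (∀ {k} (i : Δ ∋ k) → σ i ≡ τ i) → (A : F2 Δ) → sub2 S σ A ≡ sub2 S τ A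
  sub2-ext e ⊥ᶠ = refl
  sub2-ext e (app n (bound i) ts) = cong₂ (appV S) (e i) (subTs-ext (λ i → e i) ts)
  sub2-ext e (app n (free X) ts) = cong (app n (free X)) (subTs-ext (λ i → e i) ts)
  sub2-ext e (A ⇒ B) = cong₂ _⇒_ (sub2-ext e A) (sub2-ext e B)
  sub2-ext e (A ∧ B) = cong₂ _∧_ (sub2-ext e A) (sub2-ext e B)
  sub2-ext e (A ∨ B) = cong₂ _∨_ (sub2-ext e A) (sub2-ext e B)
  sub2-ext e (∀₁ A) = cong ∀₁ (sub2-ext (lift2-ext e) A)
  sub2-ext e (∃₁ A) = cong ∃₁ (sub2-ext (lift2-ext e) A)
  sub2-ext e (∀₂ n A) = cong (∀₂ n) (sub2-ext (lift2-ext e) A)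
  sub2-ext e (∃₂ n A) = cong (∃₂ n) (sub2-ext (lift2-ext e) A)

module Decoding (S : Signature) (φ : (n : ℕ) → ℕ ⤖ ℕ) (N : ℕ) where
  open Syntax S
  open Naming φ

  F1 = Form1 S

  -- inj₂ tt is the empty relation, decoded as ⊥.
  Pred : Ctx → ℕ → Set
  Pred Δ n = SV Δ n ⊎ ⊤

  -- What an L₁-term stands for after decoding: an individual and a relation of each arity.
  record Reading (Δ : Ctx) : Set where
    constructor reading
    field
      term : Tm Δ
      predAt  : (n : ℕ) → Pred Δ n
  open Reading public

  Env : Ctx → Ctx → Set
  Env Δ Δ' = Δ ∋ fo → Reading Δ'

  applyPred : ∀ {Δ n} → Pred Δ n → Vec (Tm Δ) n → F2 Δ
  applyPred {n = n} (inj₁ v) ts = app n v ts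
  applyPred (inj₂ _) ts = ⊥ᶠ

  onlyIf : ∀ {Δ} {P : Set} → Dec P → F2 Δ → F2 Δ
  onlyIf (yes _) A = A
  onlyIf (no _) A = ⊥ᶠ

  decodeAtom : ∀ {Δ} (n : ℕ) → Pred Δ n → Vec (Tm Δ) n → F2 Δ
  decodeAtom n v ts = onlyIf (n ≤? N) (applyPred v ts)

  predOf : ∀ {Δ Δ'} → Env Δ Δ' → (n : ℕ) → Tm Δ → Pred Δ' n
  predOf ρ n (bvar i) = predAt (ρ i) n
  predOf ρ n (fvar z) = inj₁ (free (from n z))
  predOf ρ n (fun f ts) = inj₂ tt

  aritiesUpTo : ℕ → List ℕ
  aritiesUpTo zero = 0 ∷ []
  aritiesUpTo (suc M) = suc M ∷ aritiesUpTo M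

  arities : List ℕ
  arities = aritiesUpTo N

  withSO : List ℕ → Ctx → Ctx
  withSO [] Δ = Δ
  withSO (m ∷ P) Δ = withSO P (so m ∷ Δ)

  allSO : ∀ {Δ} (P : List ℕ) → F2 (withSO P Δ) → F2 Δ
  allSO [] b = b
  allSO (m ∷ P) b = ∀₂ m (allSO P b)

  exSO : ∀ {Δ} (P : List ℕ) → F2 (withSO P Δ) → F2 Δ
  exSO [] b = b
  exSO (m ∷ P) b = ∃₂ m (exSO P b)

  wkSO : ∀ {Δ k} (P : List ℕ) → Δ ∋ k → withSO P Δ ∋ k
  wkSO [] i = i
  wkSO (m ∷ P) i = wkSO P (there i)

  wkPred : ∀ {Δ k n} → Pred Δ n → Pred (k ∷ Δ) n
  wkPred (inj₁ v) = inj₁ (renSV S there v)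
  wkPred (inj₂ u) = inj₂ u

  wkReading : ∀ {Δ k} → Reading Δ → Reading (k ∷ Δ)
  wkReading r = reading (renT S there (term r)) (λ n → wkPred (predAt r n))

  wkReadingSO : ∀ {Δ} (P : List ℕ) → Reading Δ → Reading (withSO P Δ)
  wkReadingSO [] r = r
  wkReadingSO (m ∷ P) r = wkReadingSO P (wkReading r)

  shiftPred : ∀ {Δ} (m n : ℕ) → Pred Δ n → Pred (so m ∷ Δ) n
  shiftPred m n v with m ≟ n
  ... | yes refl = inj₁ (bound here)
  ... | no _ = wkPred v

  shiftPredSO : ∀ {Δ} (P : List ℕ) (n : ℕ) → Pred Δ n → Pred (withSO P Δ) n
  shiftPredSO [] n v = v
  shiftPredSO (m ∷ P) n v = shiftPredSO P n (shiftPred m n v)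

  extEnv : ∀ {Δ Δ'} → Env Δ Δ' → Env (fo ∷ Δ) (withSO arities (fo ∷ Δ'))
  extEnv ρ here = reading (bvar (wkSO arities here)) (λ n → shiftPredSO arities n (inj₂ tt))
  extEnv ρ (there i) = wkReadingSO arities (wkReading (ρ i))

  decode : ∀ {Δ Δ'} → Env Δ Δ' → F1 Δ → F2 Δ'
  decode ρ ⊥ᶠ = ⊥ᶠ
  decode ρ (Ap n t ts) = decodeAtom n (predOf ρ n t) (subTs S (term ∘ ρ) ts)
  decode ρ (A ⇒ B) = decode ρ A ⇒ decode ρ B
  decode ρ (A ∧ B) = decode ρ A ∧ decode ρ B
  decode ρ (A ∨ B) = decode ρ A ∨ decode ρ B
  decode ρ (∀₁ A) = ∀₁ (allSO arities (decode (extEnv ρ) A))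
  decode ρ (∃₁ A) = ∃₁ (exSO arities (decode (extEnv ρ) A))

  -- Decoding never consults arities above N.
  ReadingEq : ∀ {Δ} → Reading Δ → Reading Δ → Set
  ReadingEq r r' = (term r ≡ term r') × (∀ n → n ≤ N → predAt r n ≡ predAt r' n)

  wkReading-eq : ∀ {Δ k} {r r' : Reading Δ} → ReadingEq r r' → ReadingEq (wkReading {k = k} r) (wkReading r')
  wkReading-eq (a , p) = cong (renT S there) a , λ n q → cong wkPred (p n q)

  wkReadingSO-eq : ∀ {Δ} (P : List ℕ) {r r' : Reading Δ} → ReadingEq r r' → ReadingEq (wkReadingSO P r) (wkReadingSO P r')
  wkReadingSO-eq [] e = e
  wkReadingSO-eq (m ∷ P) e = wkReadingSO-eq P (wkReading-eq e)

  extEnv-eq : ∀ {Δ Δ'} {ρ ρ' : Env Δ Δ'} → (∀ i → ReadingEq (ρ i) (ρ' i)) → ∀ i → ReadingEq (extEnv ρ i) (extEnv ρ' i)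
  extEnv-eq e here = refl , λ n q → refl
  extEnv-eq e (there i) = wkReadingSO-eq arities (wkReading-eq (e i))

  decodeAtom-eq : ∀ {Δ} n {v v' : Pred Δ n} {ts ts'} → (n ≤ N → v ≡ v') → ts ≡ ts' → decodeAtom n v ts ≡ decodeAtom n v' ts'
  decodeAtom-eq n e refl with n ≤? N
  ... | yes p = cong (λ v → applyPred v _) (e p)
  ... | no _ = refl

  predOf-eq : ∀ {Δ Δ'} {ρ ρ' : Env Δ Δ'} → (∀ i → ReadingEq (ρ i) (ρ' i)) → ∀ n → n ≤ N → (t : Tm Δ) → predOf ρ n t ≡ predOf ρ' n t
  predOf-eq e n q (bvar i) = proj₂ (e i) n q
  predOf-eq e n q (fvar z) = refl
  predOf-eq e n q (fun f ts) = refl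

  decode-ext : ∀ {Δ Δ'} {ρ ρ' : Env Δ Δ'} → (∀ i → ReadingEq (ρ i) (ρ' i)) → (F : F1 Δ) → decode ρ F ≡ decode ρ' F
  decode-ext e ⊥ᶠ = refl
  decode-ext e (Ap n t ts) = decodeAtom-eq n (λ q → predOf-eq e n q t) (subTs-ext (λ i → proj₁ (e i)) ts)
  decode-ext e (A ⇒ B) = cong₂ _⇒_ (decode-ext e A) (decode-ext e B)
  decode-ext e (A ∧ B) = cong₂ _∧_ (decode-ext e A) (decode-ext e B)
  decode-ext e (A ∨ B) = cong₂ _∨_ (decode-ext e A) (decode-ext e B)
  decode-ext e (∀₁ A) = cong (λ X → ∀₁ (allSO arities X)) (decode-ext (extEnv-eq e) A)
  decode-ext e (∃₁ A) = cong (λ X → ∃₁ (exSO arities X)) (decode-ext (extEnv-eq e) A)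

  -- The second-order values a reading can record; substituting them commutes with decoding.
  data SOVal (Δ : Ctx) (n : ℕ) : Set where
    var  : SV Δ n → SOVal Δ n
    absVar : ℕ → SOVal Δ n
    absBot : SOVal Δ n

  toVal2 : ∀ {Δ n} → SOVal Δ n → Val2 S (so n) Δ
  toVal2 (var v) = inj₁ v
  toVal2 {n = n} (absVar Z) = inj₂ (varAbs n Z)
  toVal2 (absBot) = inj₂ ⊥ᶠ

  toPred : ∀ {Δ n} → SOVal Δ n → Pred Δ n
  toPred (var v) = inj₁ v
  toPred (absVar Z) = inj₁ (free Z)
  toPred absBot = inj₂ tt

  wkSOVal : ∀ {Δ k n} → SOVal Δ n → SOVal (k ∷ Δ) n
  wkSOVal (var v) = var (renSV S there v)
  wkSOVal (absVar Z) = absVar Z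
  wkSOVal absBot = absBot

  toVal2-wk : ∀ {Δ k n} (v : SOVal Δ n) → wkV2 S {k' = k} (toVal2 v) ≡ toVal2 (wkSOVal v)
  toVal2-wk (var v) = refl
  toVal2-wk (absVar Z) = wkV2-varAbs Z
  toVal2-wk absBot = refl

  toPred-wk : ∀ {Δ k n} (v : SOVal Δ n) → wkPred {k = k} (toPred v) ≡ toPred (wkSOVal v)
  toPred-wk (var v) = refl
  toPred-wk (absVar Z) = refl
  toPred-wk absBot = refl

  appV-toVal2 : ∀ {Δ n} (v : SOVal Δ n) (us : Vec (Tm Δ) n) → appV S (toVal2 v) us ≡ applyPred (toPred v) us
  appV-toVal2 (var v) us = refl
  appV-toVal2 (absVar Z) us = appV-varAbs Z us
  appV-toVal2 absBot us = refl

  record NSub (Δ Δ' : Ctx) : Set where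
    constructor nsub
    field
      onFO : Δ ∋ fo → Tm Δ'
      onSO : ∀ {n} → Δ ∋ so n → SOVal Δ' n
  open NSub public

  Realizes : ∀ {Δ Δ'} → Sub2 S Δ Δ' → NSub Δ Δ' → Set
  Realizes σ τ = (∀ i → σ {fo} i ≡ onFO τ i) × (∀ {n} (i : _ ∋ so n) → σ i ≡ toVal2 (onSO τ i))

  liftOnFO : ∀ {Δ Δ' k} → (Δ ∋ fo → Tm Δ') → (k ∷ Δ) ∋ fo → Tm (k ∷ Δ')
  liftOnFO f here = bvar here
  liftOnFO f (there i) = renT S there (f i)

  liftOnSO : ∀ {Δ Δ' k} → (∀ {n} → Δ ∋ so n → SOVal Δ' n) → ∀ {n} → (k ∷ Δ) ∋ so n → SOVal (k ∷ Δ') n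
  liftOnSO f here = var (bound here)
  liftOnSO f (there i) = wkSOVal (f i)

  liftNSub : ∀ {Δ Δ' k} → NSub Δ Δ' → NSub (k ∷ Δ) (k ∷ Δ')
  liftNSub τ = nsub (liftOnFO (onFO τ)) (liftOnSO (onSO τ))

  lift-realizes : ∀ {Δ Δ' k} {σ : Sub2 S Δ Δ'} {τ} → Realizes σ τ → Realizes (lift2 S {k' = k} σ) (liftNSub τ)
  lift-realizes {σ = σ} {τ} (e1 , e2) = l1 , l2
    where
    l1 : ∀ i → lift2 S σ {fo} i ≡ liftOnFO (onFO τ) i
    l1 here = refl
    l1 (there i) = cong (renT S there) (e1 i)
    l2 : ∀ {n} i → lift2 S σ {so n} i ≡ toVal2 (liftOnSO (onSO τ) i)
    l2 here = refl
    l2 (there i) = trans (cong (wkV2 S) (e2 i)) (toVal2-wk (onSO τ i))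

  lift2SO : ∀ {Δ Δ'} (P : List ℕ) → Sub2 S Δ Δ' → Sub2 S (withSO P Δ) (withSO P Δ')
  lift2SO [] σ = σ
  lift2SO (m ∷ P) σ = lift2SO P (lift2 S σ)

  liftNSubSO : ∀ {Δ Δ'} (P : List ℕ) → NSub Δ Δ' → NSub (withSO P Δ) (withSO P Δ')
  liftNSubSO [] τ = τ
  liftNSubSO (m ∷ P) τ = liftNSubSO P (liftNSub τ)

  liftSO-realizes : ∀ {Δ Δ'} (P : List ℕ) {σ : Sub2 S Δ Δ'} {τ} → Realizes σ τ → Realizes (lift2SO P σ) (liftNSubSO P τ)
  liftSO-realizes [] e = e
  liftSO-realizes (m ∷ P) e = liftSO-realizes P (lift-realizes e)

  sub2-allSO : ∀ {Δ Δ'} (P : List ℕ) (σ : Sub2 S Δ Δ') b → sub2 S σ (allSO P b) ≡ allSO P (sub2 S (lift2SO P σ) b)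
  sub2-allSO [] σ b = refl
  sub2-allSO (m ∷ P) σ b = cong (∀₂ m) (sub2-allSO P (lift2 S σ) b)

  sub2-exSO : ∀ {Δ Δ'} (P : List ℕ) (σ : Sub2 S Δ Δ') b → sub2 S σ (exSO P b) ≡ exSO P (sub2 S (lift2SO P σ) b)
  sub2-exSO [] σ b = refl
  sub2-exSO (m ∷ P) σ b = cong (∃₂ m) (sub2-exSO P (lift2 S σ) b)

  subPred : ∀ {Δ Δ' n} → NSub Δ Δ' → Pred Δ n → Pred Δ' n
  subPred τ (inj₁ (bound j)) = toPred (onSO τ j)
  subPred τ (inj₁ (free X)) = inj₁ (free X)
  subPred τ (inj₂ u) = inj₂ u

  subReading : ∀ {Δ Δ'} → NSub Δ Δ' → Reading Δ → Reading Δ'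
  subReading τ r = reading (subT S (onFO τ) (term r)) (λ n → subPred τ (predAt r n))

  wkTermSO : ∀ {Δ} (P : List ℕ) → Tm Δ → Tm (withSO P Δ)
  wkTermSO [] t = t
  wkTermSO (m ∷ P) t = wkTermSO P (renT S there t)

  wkTermSO-bvar : ∀ {Δ} (P : List ℕ) (j : Δ ∋ fo) → wkTermSO P (bvar j) ≡ bvar (wkSO P j)
  wkTermSO-bvar [] j = refl
  wkTermSO-bvar (m ∷ P) j = wkTermSO-bvar P (there j)

  onFO-liftNSubSO : ∀ {Δ Δ'} (P : List ℕ) (τ : NSub Δ Δ') (i : Δ ∋ fo) → onFO (liftNSubSO P τ) (wkSO P i) ≡ wkTermSO P (onFO τ i)
  onFO-liftNSubSO [] τ i = refl
  onFO-liftNSubSO (m ∷ P) τ i = onFO-liftNSubSO P (liftNSub τ) (there i)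

  shiftPred-sub : ∀ {Δ Δ'} (τ : NSub Δ Δ') m n (v : Pred Δ n) → subPred (liftNSub τ) (shiftPred m n v) ≡ shiftPred m n (subPred τ v)
  shiftPred-sub τ m n v with m ≟ n
  ... | yes refl = refl
  ... | no _ with v
  ... | inj₁ (bound j) = sym (toPred-wk (onSO τ j))
  ... | inj₁ (free X) = refl
  ... | inj₂ u = refl

  shiftPredSO-sub : ∀ {Δ Δ'} (P : List ℕ) (τ : NSub Δ Δ') n (v : Pred Δ n) → subPred (liftNSubSO P τ) (shiftPredSO P n v) ≡ shiftPredSO P n (subPred τ v)
  shiftPredSO-sub [] τ n v = refl
  shiftPredSO-sub (m ∷ P) τ n v = trans (shiftPredSO-sub P (liftNSub τ) n (shiftPred m n v)) (cong (shiftPredSO P n) (shiftPred-sub τ m n v))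

  wkPred-sub : ∀ {Δ Δ' k n} (τ : NSub Δ Δ') (v : Pred Δ n) → subPred (liftNSub {k = k} τ) (wkPred v) ≡ wkPred (subPred τ v)
  wkPred-sub τ (inj₁ (bound j)) = sym (toPred-wk (onSO τ j))
  wkPred-sub τ (inj₁ (free X)) = refl
  wkPred-sub τ (inj₂ u) = refl

  ReadingEq-refl : ∀ {Δ} (r : Reading Δ) → ReadingEq r r
  ReadingEq-refl r = refl , λ n _ → refl

  ReadingEq-trans : ∀ {Δ} {r r' r'' : Reading Δ} → ReadingEq r r' → ReadingEq r' r'' → ReadingEq r r''
  ReadingEq-trans (a , p) (b , q) = trans a b , λ n l → trans (p n l) (q n l)

  wkReading-sub : ∀ {Δ Δ' k} (τ : NSub Δ Δ') (r : Reading Δ) → ReadingEq (subReading (liftNSub {k = k} τ) (wkReading r)) (wkReading (subReading τ r))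
  wkReading-sub τ r = subT-wk (onFO τ) (liftOnFO (onFO τ)) (λ _ → refl) (term r) , λ n _ → wkPred-sub τ (predAt r n)

  wkReadingSO-sub : ∀ {Δ Δ'} (P : List ℕ) (τ : NSub Δ Δ') (r : Reading Δ) → ReadingEq (subReading (liftNSubSO P τ) (wkReadingSO P r)) (wkReadingSO P (subReading τ r))
  wkReadingSO-sub [] τ r = refl , λ n _ → refl
  wkReadingSO-sub (m ∷ P) τ r = ReadingEq-trans (wkReadingSO-sub P (liftNSub τ) (wkReading r)) (wkReadingSO-eq P (wkReading-sub τ r))

  extEnv-sub : ∀ {Δ Δ' Δ''} (τ : NSub Δ' Δ'') (ρ : Env Δ Δ') → ∀ i → ReadingEq (subReading (liftNSubSO arities (liftNSub τ)) (extEnv ρ i)) (extEnv (subReading τ ∘ ρ) i)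
  extEnv-sub τ ρ here = trans (onFO-liftNSubSO arities (liftNSub τ) here) (wkTermSO-bvar arities here) , λ n _ → shiftPredSO-sub arities (liftNSub τ) n (inj₂ tt)
  extEnv-sub τ ρ (there i) = ReadingEq-trans (wkReadingSO-sub arities (liftNSub τ) (wkReading (ρ i))) (wkReadingSO-eq arities (wkReading-sub τ (ρ i)))

  sub2-onlyIf : ∀ {Δ Δ'} {P : Set} (σ : Sub2 S Δ Δ') (d : Dec P) A → sub2 S σ (onlyIf d A) ≡ onlyIf d (sub2 S σ A)
  sub2-onlyIf σ (yes _) A = refl
  sub2-onlyIf σ (no _) A = refl

  sub2-applyPred : ∀ {Δ Δ' n} {σ : Sub2 S Δ Δ'} {τ} → Realizes σ τ → (v : Pred Δ n) (us : Vec (Tm Δ) n)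
            → sub2 S σ (applyPred v us) ≡ applyPred (subPred τ v) (subTs S (onFO τ) us)
  sub2-applyPred (e1 , e2) (inj₁ (bound j)) us rewrite e2 j = trans (appV-toVal2 _ _) (cong (applyPred _) (subTs-ext e1 us))
  sub2-applyPred (e1 , e2) (inj₁ (free X)) us = cong (app _ (free X)) (subTs-ext e1 us)
  sub2-applyPred (e1 , e2) (inj₂ u) us = refl

  predOf-sub : ∀ {Δ Δ' Δ''} (τ : NSub Δ' Δ'') (ρ : Env Δ Δ') n (t : Tm Δ) → subPred τ (predOf ρ n t) ≡ predOf (subReading τ ∘ ρ) n t
  predOf-sub τ ρ n (bvar i) = refl
  predOf-sub τ ρ n (fvar z) = refl
  predOf-sub τ ρ n (fun f ts) = refl

  sub2-decode : ∀ {Δ Δ' Δ''} {σ : Sub2 S Δ' Δ''} {τ} → Realizes σ τ → (ρ : Env Δ Δ') (F : F1 Δ) → sub2 S σ (decode ρ F) ≡ decode (subReading τ ∘ ρ) F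
  sub2-decode e ρ ⊥ᶠ = refl
  sub2-decode {σ = σ} {τ} e ρ (Ap n t ts) =
    trans (sub2-onlyIf σ (n ≤? N) _)
      (cong (onlyIf (n ≤? N)) (trans (sub2-applyPred e (predOf ρ n t) _)
        (cong₂ applyPred (predOf-sub τ ρ n t) (subTs-fuse (onFO τ) _ ts))))
  sub2-decode e ρ (A ⇒ B) = cong₂ _⇒_ (sub2-decode e ρ A) (sub2-decode e ρ B)
  sub2-decode e ρ (A ∧ B) = cong₂ _∧_ (sub2-decode e ρ A) (sub2-decode e ρ B)
  sub2-decode e ρ (A ∨ B) = cong₂ _∨_ (sub2-decode e ρ A) (sub2-decode e ρ B)
  sub2-decode {σ = σ} {τ} e ρ (∀₁ A) = cong ∀₁ (trans (sub2-allSO arities (lift2 S σ) _)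
     (cong (allSO arities) (trans (sub2-decode (liftSO-realizes arities (lift-realizes e)) (extEnv ρ) A) (decode-ext (extEnv-sub τ ρ) A))))
  sub2-decode {σ = σ} {τ} e ρ (∃₁ A) = cong ∃₁ (trans (sub2-exSO arities (lift2 S σ) _)
     (cong (exSO arities) (trans (sub2-decode (liftSO-realizes arities (lift-realizes e)) (extEnv ρ) A) (decode-ext (extEnv-sub τ ρ) A))))

  readTerm : ∀ {Δ Δ'} → Env Δ Δ' → Tm Δ → Reading Δ'
  readTerm ρ t = reading (subT S (term ∘ ρ) t) (λ n → predOf ρ n t)

  wkPredSO : ∀ {Δ n} (P : List ℕ) → Pred Δ n → Pred (withSO P Δ) n
  wkPredSO [] v = v
  wkPredSO (m ∷ P) v = wkPredSO P (wkPred v)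

  term-wkReadingSO : ∀ {Δ} (P : List ℕ) (r : Reading Δ) → term (wkReadingSO P r) ≡ wkTermSO P (term r)
  term-wkReadingSO [] r = refl
  term-wkReadingSO (m ∷ P) r = term-wkReadingSO P (wkReading r)

  predAt-wkReadingSO : ∀ {Δ} (P : List ℕ) (r : Reading Δ) n → predAt (wkReadingSO P r) n ≡ wkPredSO P (predAt r n)
  predAt-wkReadingSO [] r n = refl
  predAt-wkReadingSO (m ∷ P) r n = predAt-wkReadingSO P (wkReading r) n

  wkPredSO-free : ∀ {Δ n} (P : List ℕ) X → wkPredSO {Δ} {n} P (inj₁ (free X)) ≡ inj₁ (free X)
  wkPredSO-free [] X = refl
  wkPredSO-free (m ∷ P) X = wkPredSO-free P X

  wkPredSO-empty : ∀ {Δ n} (P : List ℕ) → wkPredSO {Δ} {n} P (inj₂ tt) ≡ inj₂ tt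
  wkPredSO-empty [] = refl
  wkPredSO-empty (m ∷ P) = wkPredSO-empty P

  wkTermSO-sub : ∀ {Δ Δ'} (P : List ℕ) (σ : Δ ∋ fo → Tm Δ') (t : Tm Δ) → wkTermSO P (subT S σ t) ≡ subT S (wkTermSO P ∘ σ) t
  wkTermSO-sub [] σ t = refl
  wkTermSO-sub (m ∷ P) σ t = trans (cong (wkTermSO P) (subT-fuse _ σ t)) (wkTermSO-sub P _ t)

  readTerm-extEnv : ∀ {Δ Δ' Δ''} (ρ : Env Δ' Δ'') (τ : Δ ∋ fo → Tm Δ') → ∀ i → ReadingEq (readTerm (extEnv ρ) (liftT S τ i)) (extEnv (readTerm ρ ∘ τ) i)
  readTerm-extEnv ρ τ here = refl , λ n _ → refl
  readTerm-extEnv ρ τ (there i) = a , p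
    where
    a : subT S (term ∘ extEnv ρ) (renT S there (τ i)) ≡ term (wkReadingSO arities (wkReading (readTerm ρ (τ i))))
    a = trans (subT-fuse _ _ (τ i))
          (trans (subT-ext (λ j → term-wkReadingSO arities (wkReading (ρ j))) (τ i))
            (trans (sym (wkTermSO-sub arities (renT S there ∘ term ∘ ρ) (τ i)))
              (trans (cong (wkTermSO arities) (sym (subT-fuse _ _ (τ i)))) (sym (term-wkReadingSO arities _)))))
    p : ∀ n → n ≤ N → predOf (extEnv ρ) n (renT S there (τ i)) ≡ predAt (wkReadingSO arities (wkReading (readTerm ρ (τ i)))) n
    p n _ with τ i
    ... | bvar j = trans (predAt-wkReadingSO arities (wkReading (ρ j)) n) (sym (predAt-wkReadingSO arities _ n))
    ... | fvar z = trans (sym (wkPredSO-free arities (from n z))) (sym (predAt-wkReadingSO arities _ n))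
    ... | fun f us = trans (sym (wkPredSO-empty arities)) (sym (predAt-wkReadingSO arities _ n))

  predOf-subT : ∀ {Δ Δ' Δ''} (ρ : Env Δ' Δ'') (τ : Δ ∋ fo → Tm Δ') n (t : Tm Δ) → predOf ρ n (subT S τ t) ≡ predOf (readTerm ρ ∘ τ) n t
  predOf-subT ρ τ n (bvar i) = refl
  predOf-subT ρ τ n (fvar z) = refl
  predOf-subT ρ τ n (fun f ts) = refl

  decode-subF1 : ∀ {Δ Δ' Δ''} (ρ : Env Δ' Δ'') (τ : Δ ∋ fo → Tm Δ') (F : F1 Δ) → decode ρ (subF1 S τ F) ≡ decode (readTerm ρ ∘ τ) F
  decode-subF1 ρ τ ⊥ᶠ = refl
  decode-subF1 ρ τ (Ap n t ts) = cong₂ (decodeAtom n) (predOf-subT ρ τ n t) (subTs-fuse _ τ ts)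
  decode-subF1 ρ τ (A ⇒ B) = cong₂ _⇒_ (decode-subF1 ρ τ A) (decode-subF1 ρ τ B)
  decode-subF1 ρ τ (A ∧ B) = cong₂ _∧_ (decode-subF1 ρ τ A) (decode-subF1 ρ τ B)
  decode-subF1 ρ τ (A ∨ B) = cong₂ _∨_ (decode-subF1 ρ τ A) (decode-subF1 ρ τ B)
  decode-subF1 ρ τ (∀₁ A) = cong (λ X → ∀₁ (allSO arities X)) (trans (decode-subF1 (extEnv ρ) (liftT S τ) A) (decode-ext (readTerm-extEnv ρ τ) A))
  decode-subF1 ρ τ (∃₁ A) = cong (λ X → ∃₁ (exSO arities X)) (trans (decode-subF1 (extEnv ρ) (liftT S τ) A) (decode-ext (readTerm-extEnv ρ τ) A))

  openNSub₁ : ∀ {Δ} → Tm Δ → NSub (fo ∷ Δ) Δ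
  openNSub₁ {Δ} t = nsub f g
    where
    f : (fo ∷ Δ) ∋ fo → Tm Δ
    f here = t
    f (there i) = bvar i
    g : ∀ {n} → (fo ∷ Δ) ∋ so n → SOVal Δ n
    g (there i) = var (bound i)

  openNSub₂ : ∀ {Δ m} → SOVal Δ m → NSub (so m ∷ Δ) Δ
  openNSub₂ {Δ} {m} v = nsub f g
    where
    f : (so m ∷ Δ) ∋ fo → Tm Δ
    f (there i) = bvar i
    g : ∀ {n} → (so m ∷ Δ) ∋ so n → SOVal Δ n
    g here = v
    g (there i) = var (bound i)

  open₁Sub : ∀ {Δ} → Tm Δ → Sub2 S (fo ∷ Δ) Δ
  open₁Sub t here = t
  open₁Sub t (there i) = idv2 S i

  open₁-sub2 : ∀ {Δ} (A : F2 (fo ∷ Δ)) (t : Tm Δ) → open₁ S A t ≡ sub2 S (open₁Sub t) A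
  open₁-sub2 A t = sym (sub2-sub1 e A)
    where
    e : ∀ {k} (i : _ ∋ k) → Agrees k (open₁Sub t i) _
    e {fo} here = refl
    e {fo} (there i) = refl
    e {so n} (there i) = inj₁ refl

  open₁-allSO-decode : ∀ {Δ Δ0} (P : List ℕ) (ρ : Env Δ0 (withSO P (fo ∷ Δ))) (F : F1 Δ0) (t : Tm Δ)
          → open₁ S (allSO P (decode ρ F)) t ≡ allSO P (decode (subReading (liftNSubSO P (openNSub₁ t)) ∘ ρ) F)
  open₁-allSO-decode P ρ F t = trans (open₁-sub2 _ t) (trans (sub2-allSO P _ _) (cong (allSO P) (sub2-decode (liftSO-realizes P e) ρ F)))
    where
    e : Realizes (open₁Sub t) (openNSub₁ t)
    e = (λ { here → refl ; (there i) → refl }) , λ { (there i) → refl }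

  open₁-exSO-decode : ∀ {Δ Δ0} (P : List ℕ) (ρ : Env Δ0 (withSO P (fo ∷ Δ))) (F : F1 Δ0) (t : Tm Δ)
          → open₁ S (exSO P (decode ρ F)) t ≡ exSO P (decode (subReading (liftNSubSO P (openNSub₁ t)) ∘ ρ) F)
  open₁-exSO-decode P ρ F t = trans (open₁-sub2 _ t) (trans (sub2-exSO P _ _) (cong (exSO P) (sub2-decode (liftSO-realizes P e) ρ F)))
    where
    e : Realizes (open₁Sub t) (openNSub₁ t)
    e = (λ { here → refl ; (there i) → refl }) , λ { (there i) → refl }

  open₂Sub : ∀ {Δ m} → Val2 S (so m) Δ → Sub2 S (so m ∷ Δ) Δ
  open₂Sub v here = v
  open₂Sub v (there i) = idv2 S i

  open₂-sub2 : ∀ {Δ m} (A : F2 (so m ∷ Δ)) (V : Val2 S (so m) Δ) → open₂ S A V ≡ sub2 S (open₂Sub V) A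
  open₂-sub2 A V = sub2-ext e A
    where
    e : ∀ {k} (i : _ ∋ k) → _ ≡ open₂Sub V i
    e {so n} here = refl
    e {fo} (there i) = refl
    e {so n} (there i) = refl

  open₂-realizes : ∀ {Δ m} (v : SOVal Δ m) → Realizes (open₂Sub (toVal2 v)) (openNSub₂ v)
  open₂-realizes v = (λ { (there i) → refl }) , λ { here → refl ; (there i) → refl }

  open₂-allSO-decode : ∀ {Δ Δ0 m} (P : List ℕ) (ρ : Env Δ0 (withSO P (so m ∷ Δ))) (F : F1 Δ0) (v : SOVal Δ m)
          → open₂ S (allSO P (decode ρ F)) (toVal2 v) ≡ allSO P (decode (subReading (liftNSubSO P (openNSub₂ v)) ∘ ρ) F)
  open₂-allSO-decode P ρ F v = trans (open₂-sub2 (allSO P (decode ρ F)) (toVal2 v)) (trans (sub2-allSO P (open₂Sub (toVal2 v)) (decode ρ F)) (cong (allSO P) (sub2-decode (liftSO-realizes P (open₂-realizes v)) ρ F)))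

  open₂-exSO-decode : ∀ {Δ Δ0 m} (P : List ℕ) (ρ : Env Δ0 (withSO P (so m ∷ Δ))) (F : F1 Δ0) (v : SOVal Δ m)
          → open₂ S (exSO P (decode ρ F)) (toVal2 v) ≡ exSO P (decode (subReading (liftNSubSO P (openNSub₂ v)) ∘ ρ) F)
  open₂-exSO-decode P ρ F v = trans (open₂-sub2 (exSO P (decode ρ F)) (toVal2 v)) (trans (sub2-exSO P (open₂Sub (toVal2 v)) (decode ρ F)) (cong (exSO P) (sub2-decode (liftSO-realizes P (open₂-realizes v)) ρ F)))

  FO2-allSO : ∀ {Δ} x (P : List ℕ) (b : F2 (withSO P Δ)) → FO2 S x (allSO P b) → FO2 S x b
  FO2-allSO x [] b o = o
  FO2-allSO x (m ∷ P) b o = FO2-allSO x P b o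

  FO2-exSO : ∀ {Δ} x (P : List ℕ) (b : F2 (withSO P Δ)) → FO2 S x (exSO P b) → FO2 S x b
  FO2-exSO x [] b o = o
  FO2-exSO x (m ∷ P) b o = FO2-exSO x P b o

  FO2-allSO⁺ : ∀ {Δ} x (P : List ℕ) (b : F2 (withSO P Δ)) → FO2 S x b → FO2 S x (allSO P b)
  FO2-allSO⁺ x [] b o = o
  FO2-allSO⁺ x (m ∷ P) b o = FO2-allSO⁺ x P b o

  SO2-allSO : ∀ {Δ} m Y (P : List ℕ) (b : F2 (withSO P Δ)) → SO2 S m Y (allSO P b) → SO2 S m Y b
  SO2-allSO m Y [] b o = o
  SO2-allSO m Y (m' ∷ P) b o = SO2-allSO m Y P b o

  SO2-exSO : ∀ {Δ} m Y (P : List ℕ) (b : F2 (withSO P Δ)) → SO2 S m Y (exSO P b) → SO2 S m Y b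
  SO2-exSO m Y [] b o = o
  SO2-exSO m Y (m' ∷ P) b o = SO2-exSO m Y P b o

  SO2-allSO⁺ : ∀ {Δ} m Y (P : List ℕ) (b : F2 (withSO P Δ)) → SO2 S m Y b → SO2 S m Y (allSO P b)
  SO2-allSO⁺ m Y [] b o = o
  SO2-allSO⁺ m Y (m' ∷ P) b o = SO2-allSO⁺ m Y P b o

  FOT-wkTermSO : ∀ {Δ} x (P : List ℕ) (t : Tm Δ) → FOT S x (wkTermSO P t) → FOT S x t
  FOT-wkTermSO x [] t o = o
  FOT-wkTermSO x (m ∷ P) t o = FOT-wk x t (FOT-wkTermSO x P _ o)

  FO2-onlyIf : ∀ {Δ} {Q : Set} x (d : Dec Q) (A : F2 Δ) → FO2 S x (onlyIf d A) → FO2 S x A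
  FO2-onlyIf x (yes _) A o = o
  FO2-onlyIf x (no _) A ()

  SO2-onlyIf : ∀ {Δ} {Q : Set} m Y (d : Dec Q) (A : F2 Δ) → SO2 S m Y (onlyIf d A) → SO2 S m Y A
  SO2-onlyIf m Y (yes _) A o = o
  SO2-onlyIf m Y (no _) A ()

  FO2-applyPred : ∀ {Δ n} x (v : Pred Δ n) us → FO2 S x (applyPred v us) → FOTs S x us
  FO2-applyPred x (inj₁ v) us o = o
  FO2-applyPred x (inj₂ _) us ()

  FO2-decode : ∀ {Δ Δ'} x (ρ : Env Δ Δ') (F : F1 Δ) → FO2 S x (decode ρ F) → FO1 S x F ⊎ Σ (Δ ∋ fo) (λ i → FOT S x (term (ρ i)))
  FO2-decode x ρ ⊥ᶠ ()
  FO2-decode x ρ (Ap n t ts) o = map₁ inj₂ (FOTs-sub x (term ∘ ρ) ts (FO2-applyPred x (predOf ρ n t) _ (FO2-onlyIf x (n ≤? N) _ o)))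
  FO2-decode x ρ (A ⇒ B) (inj₁ o) = map₁ inj₁ (FO2-decode x ρ A o)
  FO2-decode x ρ (A ⇒ B) (inj₂ o) = map₁ inj₂ (FO2-decode x ρ B o)
  FO2-decode x ρ (A ∧ B) (inj₁ o) = map₁ inj₁ (FO2-decode x ρ A o)
  FO2-decode x ρ (A ∧ B) (inj₂ o) = map₁ inj₂ (FO2-decode x ρ B o)
  FO2-decode x ρ (A ∨ B) (inj₁ o) = map₁ inj₁ (FO2-decode x ρ A o)
  FO2-decode x ρ (A ∨ B) (inj₂ o) = map₁ inj₂ (FO2-decode x ρ B o)
  FO2-decode x ρ (∀₁ A) o with FO2-decode x (extEnv ρ) A (FO2-allSO x arities _ o)
  ... | inj₁ p = inj₁ p
  ... | inj₂ (here , ())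
  ... | inj₂ (there i , p) = inj₂ (i , FOT-wk x (term (ρ i)) (FOT-wkTermSO x arities _ (subst (FOT S x) (term-wkReadingSO arities (wkReading (ρ i))) p)))
  FO2-decode x ρ (∃₁ A) o with FO2-decode x (extEnv ρ) A (FO2-exSO x arities _ o)
  ... | inj₁ p = inj₁ p
  ... | inj₂ (here , ())
  ... | inj₂ (there i , p) = inj₂ (i , FOT-wk x (term (ρ i)) (FOT-wkTermSO x arities _ (subst (FOT S x) (term-wkReadingSO arities (wkReading (ρ i))) p)))

  NotFreePred : ∀ {Δ n} → Pred Δ n → Set
  NotFreePred v = ∀ Y → ¬ (v ≡ inj₁ (free Y))

  wkPred-notFree : ∀ {Δ k n} (v : Pred Δ n) → NotFreePred v → NotFreePred (wkPred {k = k} v)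
  wkPred-notFree (inj₁ (bound j)) nf Y ()
  wkPred-notFree (inj₁ (free X)) nf Y refl = nf X refl
  wkPred-notFree (inj₂ u) nf Y ()

  shiftPred-notFree : ∀ {Δ} m n (v : Pred Δ n) → NotFreePred v → NotFreePred (shiftPred m n v)
  shiftPred-notFree m n v nf with m ≟ n
  ... | yes refl = λ Y ()
  ... | no _ = wkPred-notFree v nf

  shiftPredSO-notFree : ∀ {Δ} (P : List ℕ) n (v : Pred Δ n) → NotFreePred v → NotFreePred (shiftPredSO P n v)
  shiftPredSO-notFree [] n v nf = nf
  shiftPredSO-notFree (m ∷ P) n v nf = shiftPredSO-notFree P n (shiftPred m n v) (shiftPred-notFree m n v nf)

  wkPred-free : ∀ {Δ k n} (v : Pred Δ n) Y → wkPred {k = k} v ≡ inj₁ (free Y) → v ≡ inj₁ (free Y)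
  wkPred-free (inj₁ (bound j)) Y ()
  wkPred-free (inj₁ (free X)) Y refl = refl
  wkPred-free (inj₂ u) Y ()

  wkPredSO-free⁻ : ∀ {Δ n} (P : List ℕ) (v : Pred Δ n) Y → wkPredSO P v ≡ inj₁ (free Y) → v ≡ inj₁ (free Y)
  wkPredSO-free⁻ [] v Y e = e
  wkPredSO-free⁻ (m ∷ P) v Y e = wkPred-free v Y (wkPredSO-free⁻ P (wkPred v) Y e)

  SO2-decode : ∀ {Δ Δ'} m Y (ρ : Env Δ Δ') (F : F1 Δ) → SO2 S m Y (decode ρ F) → FO1 S (to m Y) F ⊎ Σ (Δ ∋ fo) (λ i → predAt (ρ i) m ≡ inj₁ (free Y))
  SO2-decode m Y ρ ⊥ᶠ ()
  SO2-decode m Y ρ (Ap n (bvar i) ts) o = at (predAt (ρ i) n) refl (SO2-onlyIf m Y (n ≤? N) _ o)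
    where
    at : (v : Pred _ n) → predAt (ρ i) n ≡ v → SO2 S m Y (applyPred v (subTs S (term ∘ ρ) ts)) → FO1 S (to m Y) (Ap n (bvar i) ts) ⊎ Σ (_ ∋ fo) (λ i → predAt (ρ i) m ≡ inj₁ (free Y))
    at (inj₁ (bound j)) e ()
    at (inj₁ (free X)) e (refl , refl) = inj₂ (i , e)
    at (inj₂ u) e ()
  SO2-decode m Y ρ (Ap n (fvar z) ts) o with SO2-onlyIf m Y (n ≤? N) _ o
  ... | (refl , refl) = inj₁ (inj₁ (to-from n z))
  SO2-decode m Y ρ (Ap n (fun f us) ts) o with SO2-onlyIf m Y (n ≤? N) _ o
  ... | ()
  SO2-decode m Y ρ (A ⇒ B) (inj₁ o) = map₁ inj₁ (SO2-decode m Y ρ A o)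
  SO2-decode m Y ρ (A ⇒ B) (inj₂ o) = map₁ inj₂ (SO2-decode m Y ρ B o)
  SO2-decode m Y ρ (A ∧ B) (inj₁ o) = map₁ inj₁ (SO2-decode m Y ρ A o)
  SO2-decode m Y ρ (A ∧ B) (inj₂ o) = map₁ inj₂ (SO2-decode m Y ρ B o)
  SO2-decode m Y ρ (A ∨ B) (inj₁ o) = map₁ inj₁ (SO2-decode m Y ρ A o)
  SO2-decode m Y ρ (A ∨ B) (inj₂ o) = map₁ inj₂ (SO2-decode m Y ρ B o)
  SO2-decode m Y ρ (∀₁ A) o with SO2-decode m Y (extEnv ρ) A (SO2-allSO m Y arities _ o)
  ... | inj₁ p = inj₁ p
  ... | inj₂ (here , e) = ⊥-elim (shiftPredSO-notFree arities m (inj₂ tt) (λ Y ()) Y e)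
  ... | inj₂ (there i , e) = inj₂ (i , wkPred-free _ Y (wkPredSO-free⁻ arities _ Y (trans (sym (predAt-wkReadingSO arities (wkReading (ρ i)) m)) e)))
  SO2-decode m Y ρ (∃₁ A) o with SO2-decode m Y (extEnv ρ) A (SO2-exSO m Y arities _ o)
  ... | inj₁ p = inj₁ p
  ... | inj₂ (here , e) = ⊥-elim (shiftPredSO-notFree arities m (inj₂ tt) (λ Y ()) Y e)
  ... | inj₂ (there i , e) = inj₂ (i , wkPred-free _ Y (wkPredSO-free⁻ arities _ Y (trans (sym (predAt-wkReadingSO arities (wkReading (ρ i)) m)) e)))

  AritiesWithin : ∀ {Δ} → F2 Δ → Set
  AritiesWithin ⊥ᶠ = ⊤
  AritiesWithin (app n v ts) = n ≤ N
  AritiesWithin (X ⇒ Y) = AritiesWithin X × AritiesWithin Y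
  AritiesWithin (X ∧ Y) = AritiesWithin X × AritiesWithin Y
  AritiesWithin (X ∨ Y) = AritiesWithin X × AritiesWithin Y
  AritiesWithin (∀₁ X) = AritiesWithin X
  AritiesWithin (∃₁ X) = AritiesWithin X
  AritiesWithin (∀₂ n X) = AritiesWithin X
  AritiesWithin (∃₂ n X) = AritiesWithin X

module Derivations (S : Signature) (φ : (n : ℕ) → ℕ ⤖ ℕ) (N : ℕ) (k : Logic) where
  open Syntax S
  open Naming φ
  open Decoding S φ N

  infix 3 _⊢_
  _⊢_ : List (F2 []) → F2 [] → Set
  Γ ⊢ A = _⊢₂[_]_ S Γ k A

  cut : ∀ {Γ D C} → Γ ⊢ D → (D ∷ Γ) ⊢ C → Γ ⊢ C
  cut d e = ⇒E (⇒I e) d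

  coe : ∀ {Γ A B} → A ≡ B → Γ ⊢ A → Γ ⊢ B
  coe refl d = d

  cutAll : ∀ {Γ Hs C} → All (Γ ⊢_) Hs → (Hs ++ Γ) ⊢ C → Γ ⊢ C
  cutAll [] e = e
  cutAll (h ∷ hs) e = ⇒E (cutAll hs (⇒I e)) h

  data AtomicAbs : Set where
    atomAbs : ℕ → AtomicAbs
    botAbs : AtomicAbs

  toSOVal : ∀ {Δ m} → AtomicAbs → SOVal Δ m
  toSOVal (atomAbs Z) = absVar Z
  toSOVal botAbs = absBot

  ∀₂E-atomic : ∀ {Γ m} {A : F2 (so m ∷ [])} (a : AtomicAbs) → Γ ⊢ ∀₂ m A → Γ ⊢ open₂ S A (toVal2 (toSOVal a))
  ∀₂E-atomic {m = m} (atomAbs Z) d = ∀₂E (varAbs m Z) d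
  ∀₂E-atomic botAbs d = ∀₂E ⊥ᶠ d

  ∃₂I-atomic : ∀ {Γ m} {A : F2 (so m ∷ [])} (a : AtomicAbs) → Γ ⊢ open₂ S A (toVal2 (toSOVal a)) → Γ ⊢ ∃₂ m A
  ∃₂I-atomic {m = m} (atomAbs Z) d = ∃₂I (varAbs m Z) d
  ∃₂I-atomic botAbs d = ∃₂I ⊥ᶠ d

  peelReading : (P : List ℕ) (g : (m : ℕ) → SOVal [] m) → Reading (withSO P []) → Reading []
  peelReading [] g r = r
  peelReading (m ∷ P) g r = peelReading P g (subReading (liftNSubSO P (openNSub₂ (g m))) r)

  peelEnv : ∀ {Δ0} (P : List ℕ) (g : (m : ℕ) → SOVal [] m) → Env Δ0 (withSO P []) → Env Δ0 []
  peelEnv P g ρ i = peelReading P g (ρ i)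

  allSO-elim : ∀ {Γ Δ0} (P : List ℕ) (g : ℕ → AtomicAbs) (ρ : Env Δ0 (withSO P [])) (F : F1 Δ0)
           → Γ ⊢ allSO P (decode ρ F) → Γ ⊢ decode (peelEnv P (λ m → toSOVal (g m)) ρ) F
  allSO-elim [] g ρ F d = d
  allSO-elim (m ∷ P) g ρ F d = allSO-elim P g _ F (coe (open₂-allSO-decode P ρ F (toSOVal (g m))) (∀₂E-atomic (g m) d))

  exSO-intro : ∀ {Γ Δ0} (P : List ℕ) (g : ℕ → AtomicAbs) (ρ : Env Δ0 (withSO P [])) (F : F1 Δ0)
           → Γ ⊢ decode (peelEnv P (λ m → toSOVal (g m)) ρ) F → Γ ⊢ exSO P (decode ρ F)
  exSO-intro [] g ρ F d = d
  exSO-intro (m ∷ P) g ρ F d = ∃₂I-atomic (g m) (coe (sym (open₂-exSO-decode P ρ F (toSOVal (g m)))) (exSO-intro P g _ F d))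

  open₂Var : ∀ {Δ m} → SV Δ m → Sub1 S (so m ∷ Δ) Δ
  open₂Var v here = v
  open₂Var v (there i) = idv1 S i

  open₂-sub1 : ∀ {Δ m} (A : F2 (so m ∷ Δ)) (v : SV Δ m) → open₂ S A (inj₁ v) ≡ sub1 S (open₂Var v) A
  open₂-sub1 A v = trans (open₂-sub2 A (inj₁ v)) (sub2-sub1 e A)
    where
    e : ∀ {k} (i : _ ∋ k) → Agrees k (open₂Sub (inj₁ v) i) (open₂Var v i)
    e {so n} here = inj₁ refl
    e {fo} (there i) = refl
    e {so n} (there i) = inj₁ refl

  SO2-open₂ : ∀ {Δ m m'} Y Z (A : F2 (so m ∷ Δ)) → SO2 S m' Y (open₂ S A (inj₁ (free Z))) → SO2 S m' Y A ⊎ (m' ≡ m)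
  SO2-open₂ {m' = m'} Y Z A o with SO2-sub1 m' Y (open₂Var (free Z)) A (subst (SO2 S m' Y) (open₂-sub1 A (free Z)) o)
  ... | inj₁ p = inj₁ p
  ... | inj₂ (here , e) = inj₂ refl
  ... | inj₂ (there i , ())

  SO2-open₁ : ∀ {Δ m} Y (t : Tm Δ) (A : F2 (fo ∷ Δ)) → SO2 S m Y (open₁ S A t) → SO2 S m Y A
  SO2-open₁ {m = m} Y t A o with SO2-sub1 m Y _ A o
  ... | inj₁ p = p
  ... | inj₂ (there i , ())

  allSO-intro : ∀ {Γ Δ0} (P : List ℕ) (g : ℕ → ℕ) (ρ : Env Δ0 (withSO P [])) (F : F1 Δ0)
           → Unique P
           → (∀ m → m ∈ P → All (λ B → ¬ SO2 S m (g m) B) Γ)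
           → (∀ m → m ∈ P → ¬ SO2 S m (g m) (allSO P (decode ρ F)))
           → Γ ⊢ decode (peelEnv P (λ m → var (free (g m))) ρ) F → Γ ⊢ allSO P (decode ρ F)
  allSO-intro [] g ρ F u fΓ fA d = d
  allSO-intro (m ∷ P) g ρ F (m∉P ∷ u) fΓ fA d =
    ∀₂I (g m) (fΓ m (here refl)) (fA m (here refl))
      (coe (sym (open₂-allSO-decode P ρ F (var (free (g m)))))
        (allSO-intro P g _ F u (λ m' q → fΓ m' (there q)) fr d))
    where
    fr : ∀ m' → m' ∈ P → ¬ SO2 S m' (g m') (allSO P (decode _ F))
    fr m' q o with SO2-open₂ (g m') (g m) (allSO P (decode ρ F)) (subst (SO2 S m' (g m')) (sym (open₂-allSO-decode P ρ F (var (free (g m))))) o)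
    ... | inj₁ p = fA m' (there q) p
    ... | inj₂ refl = All-lookup m∉P q refl

  NSubEq : ∀ {Δ Δ'} → NSub Δ Δ' → NSub Δ Δ' → Set
  NSubEq τ τ' = (∀ i → onFO τ i ≡ onFO τ' i) × (∀ {n} (i : _ ∋ so n) → toPred (onSO τ i) ≡ toPred (onSO τ' i))

  liftNSub-eq : ∀ {Δ Δ' k'} {τ τ' : NSub Δ Δ'} → NSubEq τ τ' → NSubEq (liftNSub {k = k'} τ) (liftNSub τ')
  liftNSub-eq {τ = τ} {τ'} (e1 , e2) = l1 , l2
    where
    l1 : ∀ i → liftOnFO (onFO τ) i ≡ liftOnFO (onFO τ') i
    l1 here = refl
    l1 (there i) = cong (renT S there) (e1 i)
    l2 : ∀ {n} i → toPred (liftOnSO (onSO τ) {n} i) ≡ toPred (liftOnSO (onSO τ') i)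
    l2 here = refl
    l2 (there i) = trans (sym (toPred-wk (onSO τ i))) (trans (cong wkPred (e2 i)) (toPred-wk (onSO τ' i)))

  liftNSubSO-eq : ∀ {Δ Δ'} (P : List ℕ) {τ τ' : NSub Δ Δ'} → NSubEq τ τ' → NSubEq (liftNSubSO P τ) (liftNSubSO P τ')
  liftNSubSO-eq [] e = e
  liftNSubSO-eq (m ∷ P) e = liftNSubSO-eq P (liftNSub-eq e)

  subReading-eq : ∀ {Δ Δ'} {τ τ' : NSub Δ Δ'} {r r' : Reading Δ} → NSubEq τ τ' → ReadingEq r r' → ReadingEq (subReading τ r) (subReading τ' r')
  subReading-eq {τ = τ} {τ'} {r} {r'} (e1 , e2) (a , p) =
    trans (subT-ext e1 (term r)) (cong (subT S (onFO τ')) a) , λ n q → trans (cong (subPred τ) (p n q)) (pv (predAt r' n))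
    where
    pv : ∀ {n} (v : Pred _ n) → subPred τ v ≡ subPred τ' v
    pv (inj₁ (bound j)) = e2 j
    pv (inj₁ (free X)) = refl
    pv (inj₂ u) = refl

  fresh : List (F2 []) → F2 [] → ℕ
  fresh Γ C = nameBoundL Γ + nameBound C

  fresh-SO-Γ : ∀ Γ C m → All (λ B → ¬ SO2 S m (fresh Γ C) B) Γ
  fresh-SO-Γ Γ C m = freshSO Γ m _ (m≤m+n _ _)

  fresh-SO-C : ∀ Γ C m → ¬ SO2 S m (fresh Γ C) C
  fresh-SO-C Γ C m o = <⇒≱ (SO2-nameBound m _ C o) (m≤n+m _ _)

  fresh-FO-Γ : ∀ Γ C → All (λ B → ¬ FO2 S (fresh Γ C) B) Γ
  fresh-FO-Γ Γ C = freshFO Γ _ (m≤m+n _ _)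

  fresh-FO-C : ∀ Γ C → ¬ FO2 S (fresh Γ C) C
  fresh-FO-C Γ C o = <⇒≱ (FO2-nameBound _ C o) (m≤n+m _ _)

  exSO-modusPonens : ∀ {Δ0} (P : List ℕ) (Γ : List (F2 [])) (ρ ρ' : Env Δ0 (withSO P [])) (A W : F1 Δ0) (C : F2 [])
        → (∀ i → ReadingEq (ρ i) (ρ' i)) → (∀ (ρ'' : Env Δ0 []) → decode ρ'' W ≡ C)
        → allSO P (decode ρ' (A ⇒ W)) ∈ Γ → exSO P (decode ρ A) ∈ Γ → Γ ⊢ C
  exSO-modusPonens [] Γ ρ ρ' A W C e eW m∀ m∃ = coe (eW ρ') (⇒E (hyp m∀) (coe (decode-ext e A) (hyp m∃)))
  exSO-modusPonens (m ∷ P) Γ ρ ρ' A W C e eW m∀ m∃ =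
    ∃₂E Y (fresh-SO-Γ Γ C m) (All-lookup (fresh-SO-Γ Γ C m) m∃) (fresh-SO-C Γ C m) (hyp m∃)
      (cut (coe (open₂-allSO-decode P ρ' (A ⇒ W) (absVar Y)) (∀₂E-atomic (atomAbs Y) (hyp (there m∀))))
        (exSO-modusPonens P _ _ _ A W C e' eW (here refl) (there (here (sym (open₂-exSO-decode P ρ A (var (free Y))))))))
    where
    Y = fresh Γ C
    e' : ∀ i → ReadingEq (subReading (liftNSubSO P (openNSub₂ (var (free Y)))) (ρ i)) (subReading (liftNSubSO P (openNSub₂ (absVar Y))) (ρ' i))
    e' i = subReading-eq (liftNSubSO-eq P ((λ { (there j) → refl }) , (λ { here → refl ; (there j) → refl }))) (e i)

  NSubEq-refl : ∀ {Δ Δ'} (τ : NSub Δ Δ') → NSubEq τ τ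
  NSubEq-refl τ = (λ i → refl) , (λ i → refl)

  subReading-cong : ∀ {Δ Δ'} (τ : NSub Δ Δ') {r r' : Reading Δ} → ReadingEq r r' → ReadingEq (subReading τ r) (subReading τ r')
  subReading-cong τ = subReading-eq (NSubEq-refl τ)

  Opens : ∀ {Δ k'} → NSub (k' ∷ Δ) Δ → Set
  Opens τ = (∀ i → onFO τ (there i) ≡ bvar i) × (∀ {n} (i : _ ∋ so n) → onSO τ (there i) ≡ var (bound i))

  openNSub₁-opens : ∀ {Δ} (t : Tm Δ) → Opens (openNSub₁ t)
  openNSub₁-opens t = (λ i → refl) , (λ i → refl)

  openNSub₂-opens : ∀ {Δ m} (v : SOVal Δ m) → Opens (openNSub₂ v)
  openNSub₂-opens v = (λ i → refl) , (λ i → refl)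

  opens-wkT : ∀ {Δ k'} (τ : NSub (k' ∷ Δ) Δ) → Opens τ → (t : Tm Δ) → subT S (onFO τ) (renT S there t) ≡ t
  opens-wkT τ (o1 , o2) t = trans (subT-fuse _ _ t) (subT-id o1 t)

  opens-wkPred : ∀ {Δ k' n} (τ : NSub (k' ∷ Δ) Δ) → Opens τ → (v : Pred Δ n) → subPred τ (wkPred v) ≡ v
  opens-wkPred τ (o1 , o2) (inj₁ (bound j)) rewrite o2 j = refl
  opens-wkPred τ (o1 , o2) (inj₁ (free X)) = refl
  opens-wkPred τ (o1 , o2) (inj₂ u) = refl

  opens-wkReading : ∀ {Δ k'} (τ : NSub (k' ∷ Δ) Δ) → Opens τ → (r : Reading Δ) → ReadingEq (subReading τ (wkReading r)) r
  opens-wkReading τ o r = opens-wkT τ o (term r) , λ n _ → opens-wkPred τ o (predAt r n)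

  peelReading-wk : ∀ (P : List ℕ) g (r : Reading []) {r' : Reading (withSO P [])} → ReadingEq r' (wkReadingSO P r) → ReadingEq (peelReading P g r') r
  peelReading-wk [] g r e = e
  peelReading-wk (m ∷ P) g r {r'} e = peelReading-wk P g r (ReadingEq-trans (subReading-cong _ e)
       (ReadingEq-trans (wkReadingSO-sub P (openNSub₂ (g m)) (wkReading r)) (wkReadingSO-eq P (opens-wkReading (openNSub₂ (g m)) (openNSub₂-opens (g m)) r))))

  override : (g : (m : ℕ) → SOVal [] m) (m n : ℕ) → Pred [] n → Pred [] n
  override g m n v with m ≟ n
  ... | yes refl = toPred (g m)
  ... | no _ = v

  overrideSO : (P : List ℕ) (g : (m : ℕ) → SOVal [] m) → ((n : ℕ) → Pred [] n) → (n : ℕ) → Pred [] n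
  overrideSO [] g w = w
  overrideSO (m ∷ P) g w = overrideSO P g (λ n → override g m n (w n))

  shiftPred-open : ∀ (g : (m : ℕ) → SOVal [] m) m n (v : Pred [] n) → subPred (openNSub₂ (g m)) (shiftPred m n v) ≡ override g m n v
  shiftPred-open g m n v with m ≟ n
  ... | yes refl = refl
  ... | no _ = opens-wkPred (openNSub₂ (g m)) (openNSub₂-opens (g m)) v

  term-subReading-wk : ∀ {Δ Δ'} (P : List ℕ) (τ : NSub Δ Δ') (u : Tm Δ) → subT S (onFO (liftNSubSO P τ)) (wkTermSO P u) ≡ wkTermSO P (subT S (onFO τ) u)
  term-subReading-wk P τ u = trans (cong (subT S (onFO (liftNSubSO P τ))) (sym (term-wkReadingSO P (reading u (λ n → inj₂ tt)))))
                       (trans (proj₁ (wkReadingSO-sub P τ (reading u (λ n → inj₂ tt)))) (term-wkReadingSO P _))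

  peelReading-new : ∀ (P : List ℕ) g (t : Tm []) (w : (n : ℕ) → Pred [] n) {r : Reading (withSO P [])}
            → ReadingEq r (reading (wkTermSO P t) (λ n → shiftPredSO P n (w n))) → ReadingEq (peelReading P g r) (reading t (overrideSO P g w))
  peelReading-new [] g t w e = e
  peelReading-new (m ∷ P) g t w e = peelReading-new P g t _ (ReadingEq-trans (subReading-cong _ e)
      (trans (term-subReading-wk P (openNSub₂ (g m)) (renT S there t)) (cong (wkTermSO P) (opens-wkT (openNSub₂ (g m)) (openNSub₂-opens (g m)) t))
      , λ n _ → trans (shiftPredSO-sub P (openNSub₂ (g m)) n _) (cong (shiftPredSO P n) (shiftPred-open g m n (w n)))))

  overrideSO-keep : ∀ (P : List ℕ) g (w : (n : ℕ) → Pred [] n) n → w n ≡ toPred (g n) → overrideSO P g w n ≡ toPred (g n)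
  overrideSO-keep [] g w n e = e
  overrideSO-keep (m ∷ P) g w n e = overrideSO-keep P g _ n (u (m ≟ n))
    where
    u : Dec (m ≡ n) → override g m n (w n) ≡ toPred (g n)
    u _ with m ≟ n
    ... | yes refl = refl
    ... | no _ = e

  overrideSO-∈ : ∀ (P : List ℕ) g (w : (n : ℕ) → Pred [] n) n → n ∈ P → overrideSO P g w n ≡ toPred (g n)
  overrideSO-∈ (m ∷ P) g w n (there q) = overrideSO-∈ P g _ n q
  overrideSO-∈ (m ∷ P) g w n (here refl) = overrideSO-keep P g _ n u
    where
    u : override g n n (w n) ≡ toPred (g n)
    u with n ≟ n
    ... | yes refl = refl
    ... | no ¬p = ⊥-elim (¬p refl)

  aritiesUpTo-complete : ∀ M n → n ≤ M → n ∈ aritiesUpTo M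
  aritiesUpTo-complete zero zero z≤n = here refl
  aritiesUpTo-complete (suc M) n p with m≤n⇒m<n∨m≡n p
  ... | inj₁ q = there (aritiesUpTo-complete M n (≤-pred q))
  ... | inj₂ refl = here refl

  aritiesUpTo-bounded : ∀ M n → n ∈ aritiesUpTo M → n ≤ M
  aritiesUpTo-bounded zero n (here refl) = z≤n
  aritiesUpTo-bounded (suc M) n (here refl) = ≤-refl
  aritiesUpTo-bounded (suc M) n (there q) = ≤-trans (aritiesUpTo-bounded M n q) (n≤1+n M)

  aritiesUpTo-distinct : ∀ M → Unique (aritiesUpTo M)
  aritiesUpTo-distinct zero = [] ∷ []
  aritiesUpTo-distinct (suc M) =
    tabulate (λ q → λ { refl → <⇒≱ ≤-refl (aritiesUpTo-bounded M (suc M) q) }) ∷ aritiesUpTo-distinct M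

  consEnv : ∀ {Δ0 Δ} → Reading Δ → Env Δ0 Δ → Env (fo ∷ Δ0) Δ
  consEnv r ρ here = r
  consEnv r ρ (there i) = ρ i

  peelEnv-block : ∀ {Δ0} (ρ : Env Δ0 []) (t : Tm []) (g : (m : ℕ) → SOVal [] m)
           → ∀ i → ReadingEq (peelEnv arities g (subReading (liftNSubSO arities (openNSub₁ t)) ∘ extEnv ρ) i) (consEnv (reading t (λ n → toPred (g n))) ρ i)
  peelEnv-block ρ t g here = ReadingEq-trans (peelReading-new arities g t (λ n → inj₂ tt)
        (onFO-liftNSubSO arities (openNSub₁ t) here , λ n _ → shiftPredSO-sub arities (openNSub₁ t) n (inj₂ tt)))
        (refl , λ n q → overrideSO-∈ arities g _ n (aritiesUpTo-complete N n q))
  peelEnv-block ρ t g (there i) = peelReading-wk arities g (ρ i)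
        (ReadingEq-trans (wkReadingSO-sub arities (openNSub₁ t) (wkReading (ρ i))) (wkReadingSO-eq arities (opens-wkReading (openNSub₁ t) (openNSub₁-opens t) (ρ i))))

  decode-∀-elim : ∀ {Γ Δ0} (ρ : Env Δ0 []) (F : F1 (fo ∷ Δ0)) (t : Tm []) (g : ℕ → AtomicAbs)
          → Γ ⊢ decode ρ (∀₁ F) → Γ ⊢ decode (consEnv (reading t (λ n → toPred (toSOVal (g n)))) ρ) F
  decode-∀-elim ρ F t g d = coe (decode-ext (peelEnv-block ρ t (λ n → toSOVal (g n))) F)
                        (allSO-elim arities g _ F (coe (open₁-allSO-decode arities (extEnv ρ) F t) (∀₁E t d)))

  decode-∃-intro : ∀ {Γ Δ0} (ρ : Env Δ0 []) (F : F1 (fo ∷ Δ0)) (t : Tm []) (g : ℕ → AtomicAbs)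
          → Γ ⊢ decode (consEnv (reading t (λ n → toPred (toSOVal (g n)))) ρ) F → Γ ⊢ decode ρ (∃₁ F)
  decode-∃-intro ρ F t g d = ∃₁I t (coe (sym (open₁-exSO-decode arities (extEnv ρ) F t))
                          (exSO-intro arities g _ F (coe (sym (decode-ext (peelEnv-block ρ t (λ n → toSOVal (g n))) F)) d)))

  decode-∀-intro : ∀ {Γ Δ0} (ρ : Env Δ0 []) (F : F1 (fo ∷ Δ0)) (x : ℕ) (g : ℕ → ℕ)
           → All (λ B → ¬ FO2 S x B) Γ → ¬ FO2 S x (decode ρ (∀₁ F))
           → (∀ m → m ∈ arities → All (λ B → ¬ SO2 S m (g m) B) Γ)
           → (∀ m → m ∈ arities → ¬ SO2 S m (g m) (decode ρ (∀₁ F)))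
           → Γ ⊢ decode (consEnv (reading (fvar x) (λ n → inj₁ (free (g n)))) ρ) F → Γ ⊢ decode ρ (∀₁ F)
  decode-∀-intro ρ F x g fΓx fAx fΓ fA d =
    ∀₁I x fΓx fAx (coe (sym (open₁-allSO-decode arities (extEnv ρ) F (fvar x)))
      (allSO-intro arities g _ F (aritiesUpTo-distinct N) fΓ fA' (coe (sym (decode-ext (peelEnv-block ρ (fvar x) (λ m → var (free (g m)))) F)) d)))
    where
    fA' : ∀ m → m ∈ arities → ¬ SO2 S m (g m) (allSO arities (decode (subReading (liftNSubSO arities (openNSub₁ (fvar x))) ∘ extEnv ρ) F))
    fA' m q o = fA m q (SO2-open₁ (g m) (fvar x) (allSO arities (decode (extEnv ρ) F))
                  (subst (SO2 S m (g m)) (sym (open₁-allSO-decode arities (extEnv ρ) F (fvar x))) o))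

  decode-∃-elim-∈ : ∀ {Γ Δ0} (ρ : Env Δ0 []) (A W : F1 (fo ∷ Δ0)) (C : F2 [])
            → (∀ (ρ'' : Env (fo ∷ Δ0) []) → decode ρ'' W ≡ C)
            → decode ρ (∀₁ (A ⇒ W)) ∈ Γ → Γ ⊢ decode ρ (∃₁ A) → Γ ⊢ C
  decode-∃-elim-∈ {Γ} ρ A W C eW m∀ d∃ =
    ∃₁E x fΓ f∃ (fresh-FO-C (decode ρ (∃₁ A) ∷ Γ) C) d∃
      (cut (coe (open₁-allSO-decode arities (extEnv ρ) (A ⇒ W) (fvar x)) (∀₁E (fvar x) (hyp (there m∀))))
        (exSO-modusPonens arities _ _ _ A W C (λ i → ReadingEq-refl _) eW (here refl) (there (here (sym (open₁-exSO-decode arities (extEnv ρ) A (fvar x)))))))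
    where
    x = fresh (decode ρ (∃₁ A) ∷ Γ) C
    fΓ : All (λ B → ¬ FO2 S x B) Γ
    fΓ with fresh-FO-Γ (decode ρ (∃₁ A) ∷ Γ) C
    ... | _ ∷ r = r
    f∃ : ¬ FO2 S x (decode ρ (∃₁ A))
    f∃ with fresh-FO-Γ (decode ρ (∃₁ A) ∷ Γ) C
    ... | h ∷ _ = h

  decode-∃-elim : ∀ {Γ Δ0} (ρ : Env Δ0 []) (A W : F1 (fo ∷ Δ0)) (C : F2 [])
            → (∀ (ρ'' : Env (fo ∷ Δ0) []) → decode ρ'' W ≡ C)
            → Γ ⊢ decode ρ (∀₁ (A ⇒ W)) → Γ ⊢ decode ρ (∃₁ A) → Γ ⊢ C
  decode-∃-elim ρ A W C eW d∀ d∃ =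
    cut (∧I d∀ d∃) (cut (∧E₁ (hyp (here refl))) (decode-∃-elim-∈ ρ A W C eW (here refl) (∧E₂ (hyp (there (here refl))))))

  exSO-elim : ∀ {Γ Δ0} (P : List ℕ) (g : ℕ → ℕ) (ρ : Env Δ0 (withSO P [])) (A : F1 Δ0) (C : F2 []) → Unique P
            → (∀ m → m ∈ P → All (λ B → ¬ SO2 S m (g m) B) Γ)
            → (∀ m → m ∈ P → ¬ SO2 S m (g m) (exSO P (decode ρ A)))
            → (∀ m → m ∈ P → ¬ SO2 S m (g m) C)
            → exSO P (decode ρ A) ∈ Γ
            → (∀ Γ' → decode (peelEnv P (λ m → var (free (g m))) ρ) A ∈ Γ' → Γ' ⊢ C) → Γ ⊢ C
  exSO-elim [] g ρ A C u fΓ fA fC mem K = K _ mem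
  exSO-elim {Γ} (m ∷ P) g ρ A C (m∉P ∷ u) fΓ fA fC mem K =
    ∃₂E (g m) (fΓ m (here refl)) (All-lookup (fΓ m (here refl)) mem) (fC m (here refl)) (hyp mem)
      (exSO-elim P g _ A C u fΓ' fA' (λ m' q → fC m' (there q)) (here (sym (open₂-exSO-decode P ρ A (var (free (g m)))))) K)
    where
    X = exSO P (decode ρ A)
    hd' : ∀ m' → m' ∈ P → ¬ SO2 S m' (g m') (open₂ S X (inj₁ (free (g m))))
    hd' m' q o with SO2-open₂ (g m') (g m) X o
    ... | inj₁ p = fA m' (there q) p
    ... | inj₂ refl = All-lookup m∉P q refl
    fΓ' : ∀ m' → m' ∈ P → All (λ B → ¬ SO2 S m' (g m') B) (open₂ S X (inj₁ (free (g m))) ∷ Γ)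
    fΓ' m' q = hd' m' q ∷ fΓ m' (there q)
    fA' : ∀ m' → m' ∈ P → ¬ SO2 S m' (g m') (exSO P (decode _ A))
    fA' m' q o = hd' m' q (subst (SO2 S m' (g m')) (sym (open₂-exSO-decode P ρ A (var (free (g m))))) o)

  decode-∃-elim-fresh : ∀ {Γ Δ0} (ρ : Env Δ0 []) (A : F1 (fo ∷ Δ0)) (C : F2 []) → Γ ⊢ decode ρ (∃₁ A)
           → (∀ Γ' z → decode (consEnv (reading (fvar z) (λ n → inj₁ (free z))) ρ) A ∈ Γ' → Γ' ⊢ C) → Γ ⊢ C
  decode-∃-elim-fresh {Γ} ρ A C d K =
    ∃₁E z fΓx f∃x (fresh-FO-C (decode ρ (∃₁ A) ∷ Γ) C) d
      (exSO-elim arities (λ _ → z) _ A C (aritiesUpTo-distinct N) fΓ1 fA1 (λ m _ → fresh-SO-C (decode ρ (∃₁ A) ∷ Γ) C m)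
        (here (sym (open₁-exSO-decode arities (extEnv ρ) A (fvar z))))
        (λ Γ' mem → K Γ' z (subst (_∈ Γ') (decode-ext (peelEnv-block ρ (fvar z) (λ _ → var (free z))) A) mem)))
    where
    z = fresh (decode ρ (∃₁ A) ∷ Γ) C
    fΓx : All (λ B → ¬ FO2 S z B) Γ
    fΓx with fresh-FO-Γ (decode ρ (∃₁ A) ∷ Γ) C
    ... | _ ∷ r = r
    f∃x : ¬ FO2 S z (decode ρ (∃₁ A))
    f∃x with fresh-FO-Γ (decode ρ (∃₁ A) ∷ Γ) C
    ... | h ∷ _ = h
    sT : ∀ m → All (λ B → ¬ SO2 S m z B) Γ
    sT m with fresh-SO-Γ (decode ρ (∃₁ A) ∷ Γ) C m
    ... | _ ∷ r = r
    sH : ∀ m → ¬ SO2 S m z (decode ρ (∃₁ A))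
    sH m with fresh-SO-Γ (decode ρ (∃₁ A) ∷ Γ) C m
    ... | h ∷ _ = h
    X = exSO arities (decode (extEnv ρ) A)
    hd1 : ∀ m → ¬ SO2 S m z (open₁ S X (fvar z))
    hd1 m o = sH m (SO2-open₁ z (fvar z) X o)
    fΓ1 : ∀ m → m ∈ arities → All (λ B → ¬ SO2 S m z B) (open₁ S X (fvar z) ∷ Γ)
    fΓ1 m _ = hd1 m ∷ sT m
    fA1 : ∀ m → m ∈ arities → ¬ SO2 S m z (exSO arities (decode _ A))
    fA1 m _ o = hd1 m (subst (SO2 S m z) (sym (open₁-exSO-decode arities (extEnv ρ) A (fvar z))) o)

  emptyEnv : ∀ {Δ'} → Env [] Δ'
  emptyEnv ()

  decode₀ : ∀ {Δ'} → F1 [] → F2 Δ'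
  decode₀ F = decode emptyEnv F

  decode-closed : ∀ {Δ'} (ρ ρ' : Env [] Δ') C → decode ρ C ≡ decode ρ' C
  decode-closed ρ ρ' C = decode-ext (λ ()) C

  wk₀ : F1 [] → F1 (fo ∷ [])
  wk₀ C = subF1 S (λ ()) C

  decode-wk₀ : ∀ {Δ'} (ρ : Env (fo ∷ []) Δ') C → decode ρ (wk₀ C) ≡ decode₀ C
  decode-wk₀ ρ C = trans (decode-subF1 ρ (λ ()) C) (decode-closed _ _ C)

  decode₀-open : (A : F1 (fo ∷ [])) (t : Tm []) (r : Reading []) → ReadingEq r (readTerm emptyEnv t) → decode (consEnv r emptyEnv) A ≡ decode₀ (open¹ S A t)
  decode₀-open A t r e = trans (decode-ext (λ { here → e }) A) (sym (decode-subF1 emptyEnv _ A))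

  toAtomicAbs : ∀ {n} → Pred [] n → AtomicAbs
  toAtomicAbs (inj₁ (free Z)) = atomAbs Z
  toAtomicAbs (inj₂ _) = botAbs

  toAtomicAbs-toPred : ∀ {n} (v : Pred [] n) → toPred (toSOVal {[]} {n} (toAtomicAbs v)) ≡ v
  toAtomicAbs-toPred (inj₁ (free Z)) = refl
  toAtomicAbs-toPred (inj₂ tt) = refl

  -- The eigenvariable x of a first-order rule also serves as the second-order eigenvariables
  -- φₘ⁻¹(x) of the decoded block, so it must be fresh for the extra hypotheses Ξ in both roles.
  Covers : List (F1 []) → List (F2 []) → Set
  Covers Δ1 Ξ = ∀ x → All (λ B → ¬ FO1 S x B) Δ1 → All (λ B → ¬ FO2 S x B) Ξ × (∀ m → All (λ B → ¬ SO2 S m (from m x) B) Ξ)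

  covers-∷ : ∀ {Δ1 Ξ} B → Covers Δ1 Ξ → Covers (B ∷ Δ1) Ξ
  covers-∷ B c x (_ ∷ a) = c x a

  FO2-decode₀ : ∀ {Δ'} x (B : F1 []) → ¬ FO1 S x B → ¬ FO2 S x (decode₀ {Δ'} B)
  FO2-decode₀ x B f o with FO2-decode x emptyEnv B o
  ... | inj₁ p = f p
  ... | inj₂ (() , _)

  SO2-decode₀ : ∀ {Δ'} x m (B : F1 []) → ¬ FO1 S x B → ¬ SO2 S m (from m x) (decode₀ {Δ'} B)
  SO2-decode₀ x m B f o with SO2-decode m (from m x) emptyEnv B o
  ... | inj₁ p = f (subst (λ z → FO1 S z B) (to-from m x) p)
  ... | inj₂ (() , _)

  fresh-FO-hyps : ∀ {Δ1 Ξ} x → Covers Δ1 Ξ → All (λ B → ¬ FO1 S x B) Δ1 → All (λ B → ¬ FO2 S x B) (map decode₀ Δ1 ++ Ξ)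
  fresh-FO-hyps x c a = ++⁺ (map⁺ (mp a)) (proj₁ (c x a))
    where
    mp : ∀ {L} → All (λ B → ¬ FO1 S x B) L → All (λ B → ¬ FO2 S x (decode₀ B)) L
    mp [] = []
    mp {B ∷ L} (f ∷ fs) = FO2-decode₀ x B f ∷ mp fs

  fresh-SO-hyps : ∀ {Δ1 Ξ} x m → Covers Δ1 Ξ → All (λ B → ¬ FO1 S x B) Δ1 → All (λ B → ¬ SO2 S m (from m x) B) (map decode₀ Δ1 ++ Ξ)
  fresh-SO-hyps x m c a = ++⁺ (map⁺ (mp a)) (proj₂ (c x a) m)
    where
    mp : ∀ {L} → All (λ B → ¬ FO1 S x B) L → All (λ B → ¬ SO2 S m (from m x) (decode₀ B)) L
    mp [] = []
    mp {B ∷ L} (f ∷ fs) = SO2-decode₀ x m B f ∷ mp fs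

  freshReading : ℕ → Reading []
  freshReading x = reading (fvar x) (λ n → inj₁ (free (from n x)))

  decode-sound : ∀ {Δ1 F} → _⊢₁[_]_ S Δ1 k F → ∀ Ξ → Covers Δ1 Ξ → (map decode₀ Δ1 ++ Ξ) ⊢ decode₀ F
  decode-sound (hyp m) Ξ c = hyp (∈-++⁺ˡ (∈-map⁺ decode₀ m))
  decode-sound (⊥E d) Ξ c = ⊥E (decode-sound d Ξ c)
  decode-sound (raa d) Ξ c = raa (decode-sound d Ξ (covers-∷ _ c))
  decode-sound (⇒I d) Ξ c = ⇒I (decode-sound d Ξ (covers-∷ _ c))
  decode-sound (⇒E d e) Ξ c = ⇒E (decode-sound d Ξ c) (decode-sound e Ξ c)
  decode-sound (∧I d e) Ξ c = ∧I (decode-sound d Ξ c) (decode-sound e Ξ c)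
  decode-sound (∧E₁ d) Ξ c = ∧E₁ (decode-sound d Ξ c)
  decode-sound (∧E₂ d) Ξ c = ∧E₂ (decode-sound d Ξ c)
  decode-sound (∨I₁ d) Ξ c = ∨I₁ (decode-sound d Ξ c)
  decode-sound (∨I₂ d) Ξ c = ∨I₂ (decode-sound d Ξ c)
  decode-sound (∨E d e f) Ξ c = ∨E (decode-sound d Ξ c) (decode-sound e Ξ (covers-∷ _ c)) (decode-sound f Ξ (covers-∷ _ c))
  decode-sound {Δ1} (∀₁I {A = A} x fΔ fA d) Ξ c =
    decode-∀-intro emptyEnv A x (λ m → from m x) (fresh-FO-hyps x c fΔ) (FO2-decode₀ x (∀₁ A) fA)
      (λ m _ → fresh-SO-hyps x m c fΔ) (λ m _ → SO2-decode₀ x m (∀₁ A) fA)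
      (coe (sym (decode₀-open A (fvar x) (freshReading x) (ReadingEq-refl _))) (decode-sound d Ξ c))
  decode-sound (∀₁E {A = A} t d) Ξ c =
    coe (decode₀-open A t _ (sym (subT-id (λ ()) t) , λ n _ → toAtomicAbs-toPred (predOf emptyEnv n t)))
      (decode-∀-elim emptyEnv A t (λ n → toAtomicAbs (predOf emptyEnv n t)) (decode-sound d Ξ c))
  decode-sound (∃₁I {A = A} t d) Ξ c =
    decode-∃-intro emptyEnv A t (λ n → toAtomicAbs (predOf emptyEnv n t))
      (coe (sym (decode₀-open A t _ (sym (subT-id (λ ()) t) , λ n _ → toAtomicAbs-toPred (predOf emptyEnv n t)))) (decode-sound d Ξ c))
  decode-sound {Δ1} (∃₁E {A = A} {C = F} x fΔ f∃ fC d∃ dC) Ξ c =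
    decode-∃-elim emptyEnv A (wk₀ F) (decode₀ F) (λ ρ'' → decode-wk₀ ρ'' F) d∀ (decode-sound d∃ Ξ c)
    where
    L = map decode₀ Δ1 ++ Ξ
    dC' : (decode₀ (open¹ S A (fvar x)) ∷ L) ⊢ decode₀ F
    dC' = decode-sound dC Ξ (covers-∷ _ c)
    fAx : ¬ FO2 S x (decode₀ (∀₁ (A ⇒ wk₀ F)))
    fAx o with FO2-allSO x arities _ o
    ... | inj₁ p = FO2-decode₀ x (∀₁ A) f∃ (FO2-allSO⁺ x arities _ p)
    ... | inj₂ p = FO2-decode₀ x F fC (subst (FO2 S x) (decode-wk₀ _ F) p)
    sAx : ∀ m → ¬ SO2 S m (from m x) (decode₀ (∀₁ (A ⇒ wk₀ F)))
    sAx m o with SO2-allSO m _ arities _ o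
    ... | inj₁ p = SO2-decode₀ x m (∀₁ A) f∃ (SO2-allSO⁺ m _ arities _ p)
    ... | inj₂ p = SO2-decode₀ x m F fC (subst (SO2 S m (from m x)) (decode-wk₀ _ F) p)
    d∀ : L ⊢ decode₀ (∀₁ (A ⇒ wk₀ F))
    d∀ = decode-∀-intro emptyEnv (A ⇒ wk₀ F) x (λ m → from m x) (fresh-FO-hyps x c fΔ) fAx
           (λ m _ → fresh-SO-hyps x m c fΔ) (λ m _ → sAx m)
           (⇒I (coe (sym (decode-wk₀ _ F)) (subst (λ X → (X ∷ L) ⊢ decode₀ F) (sym (decode₀-open A (fvar x) (freshReading x) (ReadingEq-refl _))) dC')))

  extSub1 : ∀ {Δ Δ' k'} → Sub1 S Δ Δ' → Val1 S k' Δ' → Sub1 S (k' ∷ Δ) Δ'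
  extSub1 σ v here = v
  extSub1 σ v (there i) = σ i

  sub1-extSub1 : ∀ {Δ Δ' k'} (σ : Sub1 S Δ Δ') (v : Val1 S k' Δ') (X : F2 (k' ∷ Δ))
            → sub1 S (extSub1 (idv1 S) v) (sub1 S (lift1 S σ) X) ≡ sub1 S (extSub1 σ v) X
  sub1-extSub1 σ v X = trans (sub1-fuse _ _ X) (sub1-ext e X)
    where
    e : ∀ {k} (i : _ ∋ k) → (extSub1 (idv1 S) v ∘₁ lift1 S σ) i ≡ extSub1 σ v i
    e {fo} here = refl
    e {so n} here = refl
    e {fo} (there i) = trans (subT-fuse _ _ (σ i)) (subT-id (λ j → refl) (σ i))
    e {so n} (there i) with σ i
    ... | bound j = refl
    ... | free X = refl

  open₁-lift1 : ∀ {Δ} (σ : Sub1 S Δ []) (t : Tm []) (X : F2 (fo ∷ Δ)) → open₁ S (sub1 S (lift1 S σ) X) t ≡ sub1 S (extSub1 σ t) X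
  open₁-lift1 σ t X = trans (trans (open₁-sub2 _ t) (sub2-sub1 e _)) (sub1-extSub1 σ t X)
    where
    e : ∀ {k} (i : _ ∋ k) → Agrees k (open₁Sub t i) (extSub1 (idv1 S) t i)
    e {fo} here = refl
    e {fo} (there i) = refl
    e {so n} (there i) = inj₁ refl

  open₂-lift1-var : ∀ {Δ n} (σ : Sub1 S Δ []) (Z : ℕ) (X : F2 (so n ∷ Δ)) → open₂ S (sub1 S (lift1 S σ) X) (inj₁ (free Z)) ≡ sub1 S (extSub1 σ (free Z)) X
  open₂-lift1-var σ Z X = trans (trans (open₂-sub2 (sub1 S (lift1 S σ) X) (inj₁ (free Z))) (sub2-sub1 e _)) (sub1-extSub1 σ (free Z) X)
    where
    e : ∀ {k} (i : _ ∋ k) → Agrees k (open₂Sub (inj₁ (free Z)) i) (extSub1 (idv1 S) (free Z) i)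
    e {so n} here = inj₁ refl
    e {fo} (there i) = refl
    e {so n} (there i) = inj₁ refl

  open₂-lift1-atom : ∀ {Δ n} (σ : Sub1 S Δ []) (Z : ℕ) (X : F2 (so n ∷ Δ)) → open₂ S (sub1 S (lift1 S σ) X) (toVal2 (absVar Z)) ≡ sub1 S (extSub1 σ (free Z)) X
  open₂-lift1-atom σ Z X = trans (trans (open₂-sub2 (sub1 S (lift1 S σ) X) (toVal2 (absVar Z))) (sub2-sub1 e _)) (sub1-extSub1 σ (free Z) X)
    where
    e : ∀ {k} (i : _ ∋ k) → Agrees k (open₂Sub (toVal2 (absVar Z)) i) (extSub1 (idv1 S) (free Z) i)
    e {so n} here = inj₂ (Z , refl , refl)
    e {fo} (there i) = refl
    e {so n} (there i) = inj₁ refl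

  Tracks : ∀ {Δ} → Sub1 S Δ [] → Env ⌜ Δ ⌝ [] → Set
  Tracks {Δ} σ ρ = (∀ (i : Δ ∋ fo) → term (ρ (cv i)) ≡ σ i) × (∀ {n} (i : Δ ∋ so n) → predAt (ρ (cv i)) n ≡ inj₁ (σ i))

  varReading : ℕ → Reading []
  varReading z = reading (fvar z) (λ _ → inj₁ (free z))

  tracks-fo : ∀ {Δ} {σ : Sub1 S Δ []} {ρ} z → Tracks σ ρ → Tracks (extSub1 {k' = fo} σ (fvar z)) (consEnv (varReading z) ρ)
  tracks-fo z (i1 , i2) = (λ { here → refl ; (there i) → i1 i }) , (λ { (there i) → i2 i })

  tracks-so : ∀ {Δ n} {σ : Sub1 S Δ []} {ρ} z → Tracks σ ρ → Tracks (extSub1 {k' = so n} σ (free z)) (consEnv (varReading z) ρ)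
  tracks-so z (i1 , i2) = (λ { (there i) → i1 i }) , (λ { here → refl ; (there i) → i2 i })

  decodeAtom-within : ∀ {Δ n} (v : Pred Δ n) us → n ≤ N → decodeAtom n v us ≡ applyPred v us
  decodeAtom-within {n = n} v us p with n ≤? N
  ... | yes _ = refl
  ... | no ¬p = ⊥-elim (¬p p)

  decodeCode : ∀ {Δ} → Env ⌜ Δ ⌝ [] → F2 Δ → F2 []
  decodeCode ρ X = decode ρ (code S φ X)

  decode-atomAbs : ∀ {Δ0} (ρ : Env Δ0 []) z (F : F1 (fo ∷ Δ0)) → decode (consEnv (reading (fvar z) (λ n → toPred (toSOVal {[]} {n} (atomAbs z)))) ρ) F ≡ decode (consEnv (varReading z) ρ) F
  decode-atomAbs ρ z F = decode-ext (λ { here → refl , (λ n _ → refl) ; (there i) → ReadingEq-refl _ }) F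

  decodeCode-atom : ∀ {Δ n} {σ : Sub1 S Δ []} {ρ : Env ⌜ Δ ⌝ []} (v : SV Δ n) (ts : Vec (Tm Δ) n)
                  → n ≤ N → Tracks σ ρ → decodeCode ρ (app n v ts) ≡ sub1 S σ (app n v ts)
  decodeCode-atom (bound i) ts b (i1 , i2) =
    trans (decodeAtom-within _ _ b) (cong₂ applyPred (i2 i) (trans (subTs-fuse _ _ ts) (subTs-ext i1 ts)))
  decodeCode-atom {n = n} (free X) ts b (i1 , i2) =
    trans (decodeAtom-within _ _ b)
          (cong₂ (λ Y us → app n (free Y) us) (from-to n X) (trans (subTs-fuse _ _ ts) (subTs-ext i1 ts)))

  mutual
    ⊢decode-code : ∀ {Δ} (X : F2 Δ) → AritiesWithin X → (σ : Sub1 S Δ []) (ρ : Env ⌜ Δ ⌝ []) → Tracks σ ρ → ∀ Ξ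
        → (sub1 S σ X ∷ Ξ) ⊢ decodeCode ρ X
    ⊢decode-code ⊥ᶠ b σ ρ iv Ξ = hyp (here refl)
    ⊢decode-code (app n v ts) b σ ρ iv Ξ = hyp (here (decodeCode-atom v ts b iv))
    ⊢decode-code (X ⇒ Y) (bX , bY) σ ρ iv Ξ =
      ⇒I (cut (⇒E (hyp (there (here refl))) (cut (hyp (here refl)) (decode-code⊢ X bX σ ρ iv _))) (⊢decode-code Y bY σ ρ iv _))
    ⊢decode-code (X ∧ Y) (bX , bY) σ ρ iv Ξ =
      ∧I (cut (∧E₁ (hyp (here refl))) (⊢decode-code X bX σ ρ iv _)) (cut (∧E₂ (hyp (here refl))) (⊢decode-code Y bY σ ρ iv _))
    ⊢decode-code (X ∨ Y) (bX , bY) σ ρ iv Ξ =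
      ∨E (hyp (here refl)) (∨I₁ (⊢decode-code X bX σ ρ iv _)) (∨I₂ (⊢decode-code Y bY σ ρ iv _))
    ⊢decode-code (∀₁ X) b σ ρ iv Ξ =
      decode-∀-intro ρ (code S φ X) z (λ _ → z) (fresh-FO-Γ Γ Gl) (fresh-FO-C Γ Gl) (λ m _ → fresh-SO-Γ Γ Gl m) (λ m _ → fresh-SO-C Γ Gl m)
        (cut (coe (open₁-lift1 σ (fvar z) X) (∀₁E (fvar z) (hyp (here refl)))) (⊢decode-code X b _ _ (tracks-fo z iv) Γ))
      where
      Γ = sub1 S σ (∀₁ X) ∷ Ξ
      Gl = decodeCode ρ (∀₁ X)
      z = fresh Γ Gl
    ⊢decode-code (∀₂ n X) b σ ρ iv Ξ =
      decode-∀-intro ρ (code S φ X) z (λ _ → z) (fresh-FO-Γ Γ Gl) (fresh-FO-C Γ Gl) (λ m _ → fresh-SO-Γ Γ Gl m) (λ m _ → fresh-SO-C Γ Gl m)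
        (cut (coe (open₂-lift1-atom σ z X) (∀₂E (varAbs n z) (hyp (here refl)))) (⊢decode-code X b _ _ (tracks-so z iv) Γ))
      where
      Γ = sub1 S σ (∀₂ n X) ∷ Ξ
      Gl = decodeCode ρ (∀₂ n X)
      z = fresh Γ Gl
    ⊢decode-code (∃₁ X) b σ ρ iv Ξ =
      ∃₁E z (fresh-FO-Γ Γ Gl) (All-lookup (fresh-FO-Γ Γ Gl) (here refl)) (fresh-FO-C Γ Gl) (hyp (here refl))
        (decode-∃-intro ρ (code S φ X) (fvar z) (λ _ → atomAbs z)
          (coe (sym (decode-atomAbs ρ z (code S φ X))) (cut (coe (open₁-lift1 σ (fvar z) X) (hyp (here refl))) (⊢decode-code X b _ _ (tracks-fo z iv) _))))
      where
      Γ = sub1 S σ (∃₁ X) ∷ Ξ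
      Gl = decodeCode ρ (∃₁ X)
      z = fresh Γ Gl
    ⊢decode-code (∃₂ n X) b σ ρ iv Ξ =
      ∃₂E z (fresh-SO-Γ Γ Gl n) (All-lookup (fresh-SO-Γ Γ Gl n) (here refl)) (fresh-SO-C Γ Gl n) (hyp (here refl))
        (decode-∃-intro ρ (code S φ X) (fvar z) (λ _ → atomAbs z)
          (coe (sym (decode-atomAbs ρ z (code S φ X))) (cut (coe (open₂-lift1-var σ z X) (hyp (here refl))) (⊢decode-code X b _ _ (tracks-so z iv) _))))
      where
      Γ = sub1 S σ (∃₂ n X) ∷ Ξ
      Gl = decodeCode ρ (∃₂ n X)
      z = fresh Γ Gl

    decode-code⊢ : ∀ {Δ} (X : F2 Δ) → AritiesWithin X → (σ : Sub1 S Δ []) (ρ : Env ⌜ Δ ⌝ []) → Tracks σ ρ → ∀ Ξ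
        → (decodeCode ρ X ∷ Ξ) ⊢ sub1 S σ X
    decode-code⊢ ⊥ᶠ b σ ρ iv Ξ = hyp (here refl)
    decode-code⊢ (app n v ts) b σ ρ iv Ξ = hyp (here (sym (decodeCode-atom v ts b iv)))
    decode-code⊢ (X ⇒ Y) (bX , bY) σ ρ iv Ξ =
      ⇒I (cut (⇒E (hyp (there (here refl))) (cut (hyp (here refl)) (⊢decode-code X bX σ ρ iv _))) (decode-code⊢ Y bY σ ρ iv _))
    decode-code⊢ (X ∧ Y) (bX , bY) σ ρ iv Ξ =
      ∧I (cut (∧E₁ (hyp (here refl))) (decode-code⊢ X bX σ ρ iv _)) (cut (∧E₂ (hyp (here refl))) (decode-code⊢ Y bY σ ρ iv _))
    decode-code⊢ (X ∨ Y) (bX , bY) σ ρ iv Ξ =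
      ∨E (hyp (here refl)) (∨I₁ (decode-code⊢ X bX σ ρ iv _)) (∨I₂ (decode-code⊢ Y bY σ ρ iv _))
    decode-code⊢ (∀₁ X) b σ ρ iv Ξ =
      ∀₁I z (fresh-FO-Γ Γ Gl) (fresh-FO-C Γ Gl)
        (coe (sym (open₁-lift1 σ (fvar z) X))
          (cut (coe (decode-atomAbs ρ z (code S φ X)) (decode-∀-elim ρ (code S φ X) (fvar z) (λ _ → atomAbs z) (hyp (here refl))))
            (decode-code⊢ X b _ _ (tracks-fo z iv) Γ)))
      where
      Γ = decodeCode ρ (∀₁ X) ∷ Ξ
      Gl = sub1 S σ (∀₁ X)
      z = fresh Γ Gl
    decode-code⊢ (∀₂ n X) b σ ρ iv Ξ =
      ∀₂I z (fresh-SO-Γ Γ Gl n) (fresh-SO-C Γ Gl n)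
        (coe (sym (open₂-lift1-var σ z X))
          (cut (coe (decode-atomAbs ρ z (code S φ X)) (decode-∀-elim ρ (code S φ X) (fvar z) (λ _ → atomAbs z) (hyp (here refl))))
            (decode-code⊢ X b _ _ (tracks-so z iv) Γ)))
      where
      Γ = decodeCode ρ (∀₂ n X) ∷ Ξ
      Gl = sub1 S σ (∀₂ n X)
      z = fresh Γ Gl
    decode-code⊢ (∃₁ X) b σ ρ iv Ξ =
      decode-∃-elim-fresh ρ (code S φ X) (sub1 S σ (∃₁ X)) (hyp (here refl))
        (λ Γ' z mem → ∃₁I (fvar z) (coe (sym (open₁-lift1 σ (fvar z) X)) (cut (hyp mem) (decode-code⊢ X b _ _ (tracks-fo z iv) Γ'))))
    decode-code⊢ (∃₂ n X) b σ ρ iv Ξ =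
      decode-∃-elim-fresh ρ (code S φ X) (sub1 S σ (∃₂ n X)) (hyp (here refl))
        (λ Γ' z mem → ∃₂I (varAbs n z) (coe (sym (open₂-lift1-atom σ z X)) (cut (hyp mem) (decode-code⊢ X b _ _ (tracks-so z iv) Γ'))))

  tracks-empty : Tracks (λ ()) emptyEnv
  tracks-empty = (λ ()) , (λ ())

  sub1-empty : (F : F2 []) → sub1 S (λ ()) F ≡ F
  sub1-empty F = sub1-id (λ ()) F

  ⊢decode₀-code : ∀ {Ξ} (F : F2 []) → AritiesWithin F → Ξ ⊢ F → Ξ ⊢ decode₀ (code S φ F)
  ⊢decode₀-code F b d = cut (coe (sym (sub1-empty F)) d) (⊢decode-code F b (λ ()) emptyEnv tracks-empty _)

  decode₀-code⊢ : ∀ {Ξ} (F : F2 []) → AritiesWithin F → Ξ ⊢ decode₀ (code S φ F) → Ξ ⊢ F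
  decode₀-code⊢ F b d = coe (sub1-empty F) (cut d (decode-code⊢ F b (λ ()) emptyEnv tracks-empty _))

  sv2 : ∀ {Δ Δ' n} → Sub2 S Δ Δ' → SV Δ n → Val2 S (so n) Δ'
  sv2 σ (bound j) = σ j
  sv2 σ (free X) = inj₁ (free X)

  _∘₂₁_ : ∀ {Δ Δ' Δ''} → Sub2 S Δ' Δ'' → Sub1 S Δ Δ' → Sub2 S Δ Δ''
  (σ ∘₂₁ τ) {fo} i = subT S σ (τ i)
  (σ ∘₂₁ τ) {so n} i = sv2 σ (τ i)

  lift-∘₂₁ : ∀ {Δ Δ' Δ'' k'} (σ : Sub2 S Δ' Δ'') (τ : Sub1 S Δ Δ') → ∀ {k} (i : (k' ∷ Δ) ∋ k)
          → (lift2 S σ ∘₂₁ lift1 S τ) i ≡ lift2 S (σ ∘₂₁ τ) i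
  lift-∘₂₁ σ τ {fo} here = refl
  lift-∘₂₁ σ τ {so n} here = refl
  lift-∘₂₁ σ τ {fo} (there i) = subT-wk (λ j → σ j) (λ j → lift2 S σ j) (λ _ → refl) (τ i)
  lift-∘₂₁ σ τ {so n} (there i) with τ i
  ... | bound j = refl
  ... | free X = refl

  sub21-fuse : ∀ {Δ Δ' Δ''} (σ : Sub2 S Δ' Δ'') (τ : Sub1 S Δ Δ') (X : F2 Δ) → sub2 S σ (sub1 S τ X) ≡ sub2 S (σ ∘₂₁ τ) X
  sub21-fuse σ τ ⊥ᶠ = refl
  sub21-fuse σ τ (app n (bound i) ts) with τ i
  ... | bound j = cong (appV S (σ j)) (subTs-fuse (λ j → σ j) (λ j → τ j) ts)
  ... | free X = cong (app n (free X)) (subTs-fuse (λ j → σ j) (λ j → τ j) ts)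
  sub21-fuse σ τ (app n (free X) ts) = cong (app n (free X)) (subTs-fuse (λ j → σ j) (λ j → τ j) ts)
  sub21-fuse σ τ (X ⇒ Y) = cong₂ _⇒_ (sub21-fuse σ τ X) (sub21-fuse σ τ Y)
  sub21-fuse σ τ (X ∧ Y) = cong₂ _∧_ (sub21-fuse σ τ X) (sub21-fuse σ τ Y)
  sub21-fuse σ τ (X ∨ Y) = cong₂ _∨_ (sub21-fuse σ τ X) (sub21-fuse σ τ Y)
  sub21-fuse σ τ (∀₁ X) = cong ∀₁ (trans (sub21-fuse _ _ X) (sub2-ext (lift-∘₂₁ σ τ) X))
  sub21-fuse σ τ (∃₁ X) = cong ∃₁ (trans (sub21-fuse _ _ X) (sub2-ext (lift-∘₂₁ σ τ) X))
  sub21-fuse σ τ (∀₂ n X) = cong (∀₂ n) (trans (sub21-fuse _ _ X) (sub2-ext (lift-∘₂₁ σ τ) X))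
  sub21-fuse σ τ (∃₂ n X) = cong (∃₂ n) (trans (sub21-fuse _ _ X) (sub2-ext (lift-∘₂₁ σ τ) X))

  lift2Fos : ∀ {Δ Δ'} (n : ℕ) → Sub2 S Δ Δ' → Sub2 S (fos n ++ Δ) (fos n ++ Δ')
  lift2Fos zero σ = σ
  lift2Fos (suc n) σ = lift2 S (lift2Fos n σ)

  sub2-allFO : ∀ {Δ Δ'} (n : ℕ) (σ : Sub2 S Δ Δ') (F : F2 (fos n ++ Δ)) → sub2 S σ (allFO S n F) ≡ allFO S n (sub2 S (lift2Fos n σ) F)
  sub2-allFO zero σ F = refl
  sub2-allFO (suc n) σ F = sub2-allFO n σ (∀₁ F)

  foIndex : ∀ {Δ} n → Fin n → (fos n ++ Δ) ∋ fo
  foIndex (suc n) zero = here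
  foIndex (suc n) (suc j) = there (foIndex n j)

  inst-ix : ∀ {Δ n} (us : Vec (Tm Δ) n) j → inst S us (foIndex n j) ≡ lookup us j
  inst-ix (u ∷ us) zero = refl
  inst-ix (u ∷ us) (suc j) = inst-ix us j

  lookup-subTs : ∀ {Δ Δ' n} (σ : Δ ∋ fo → Tm Δ') (ts : Vec (Tm Δ) n) j → lookup (subTs S σ ts) j ≡ subT S σ (lookup ts j)
  lookup-subTs σ (t ∷ ts) zero = refl
  lookup-subTs σ (t ∷ ts) (suc j) = lookup-subTs σ ts j

  lookup-last : ∀ {A : Set} {n} (v : Vec A n) (y : A) → lookup (v ∷ʳ y) (fromℕ n) ≡ y
  lookup-last [] y = refl
  lookup-last (x ∷ v) y = lookup-last v y

  lookup-inj : ∀ {A : Set} {n} (v : Vec A n) (y : A) j → lookup (v ∷ʳ y) (inject₁ j) ≡ lookup v j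
  lookup-inj (x ∷ v) y zero = refl
  lookup-inj (x ∷ v) y (suc j) = lookup-inj v y j

  xs-opposite : ∀ {Δ} n (j : Fin n) → lookup (xs S {Δ} n) (opposite j) ≡ bvar (foIndex n j)
  xs-opposite (suc n) zero = lookup-last (subTs S (bvar ∘ there) (xs S n)) (bvar here)
  xs-opposite (suc n) (suc j) = trans (lookup-inj (subTs S (bvar ∘ there) (xs S n)) (bvar here) (opposite j)) (trans (lookup-subTs _ (xs S n) (opposite j)) (cong (renT S there) (xs-opposite n j)))

  xs-lookup : ∀ {Δ} n (j : Fin n) → lookup (xs S {Δ} n) j ≡ bvar (foIndex n (opposite j))
  xs-lookup n j = trans (cong (lookup (xs S n)) (sym (opposite-involutive j))) (xs-opposite n (opposite j))

  liftN-ix : ∀ {Δ Δ'} n (ρ : Ren Δ Δ') j → liftN n ρ (foIndex n j) ≡ foIndex n j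
  liftN-ix (suc n) ρ zero = refl
  liftN-ix (suc n) ρ (suc j) = cong there (liftN-ix n ρ j)

  foIndex-surjective : ∀ n (i : (fos n ++ []) ∋ fo) → Σ (Fin n) (λ j → i ≡ foIndex n j)
  foIndex-surjective zero ()
  foIndex-surjective (suc n) here = zero , refl
  foIndex-surjective (suc n) (there i) with foIndex-surjective n i
  ... | j , refl = suc j , refl

  fos-no-so : ∀ n {m} → ¬ ((fos n ++ []) ∋ so m)
  fos-no-so zero ()
  fos-no-so (suc n) (there i) = fos-no-so n i

  subTs-xs : ∀ {Δ Δ'} n (σ : Sub2 S Δ Δ') → subTs S (λ i → lift2Fos n σ i) (xs S n) ≡ xs S n
  subTs-xs zero σ = refl
  subTs-xs (suc n) σ = trans (subTs-∷ʳ _ (subTs S (bvar ∘ there) (xs S n)) (bvar here))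
      (cong (_∷ʳ bvar here) (trans (subTs-wk (λ i → lift2Fos n σ i) (λ i → lift2 S (lift2Fos n σ) i) (λ _ → refl) (xs S n))
        (cong (subTs S (bvar ∘ there)) (subTs-xs n σ))))
    where
    subTs-∷ʳ : ∀ {Δ Δ' m} (τ : Δ ∋ fo → Tm Δ') (v : Vec (Tm Δ) m) y → subTs S τ (v ∷ʳ y) ≡ subTs S τ v ∷ʳ subT S τ y
    subTs-∷ʳ τ [] y = refl
    subTs-∷ʳ τ (x ∷ v) y = cong (subT S τ x ∷_) (subTs-∷ʳ τ v y)

  wkVal2Fos : ∀ {Δ n} (m : ℕ) → Val2 S (so n) Δ → Val2 S (so n) (fos m ++ Δ)
  wkVal2Fos zero v = v
  wkVal2Fos (suc m) v = wkV2 S (wkVal2Fos m v)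

  lift2Fos-wkFos : ∀ {Δ Δ' n} (m : ℕ) (σ : Sub2 S (so n ∷ Δ) Δ') → lift2Fos m σ (wkFos m here) ≡ wkVal2Fos m (σ here)
  lift2Fos-wkFos zero σ = refl
  lift2Fos-wkFos (suc m) σ = cong (wkV2 S) (lift2Fos-wkFos m σ)

  fromEmpty : ∀ {Δ} → Ren [] Δ
  fromEmpty ()

  liftN-empty : ∀ n {Δ1 Δ2} (ρ : Ren Δ1 Δ2) (ρ' : Ren [] Δ1) (ρ'' : Ren [] Δ2) → ∀ {k} (i : (fos n ++ []) ∋ k)
              → liftN n ρ (liftN n ρ' i) ≡ liftN n ρ'' i
  liftN-empty zero ρ ρ' ρ'' ()
  liftN-empty (suc n) ρ ρ' ρ'' here = refl
  liftN-empty (suc n) ρ ρ' ρ'' (there i) = cong there (liftN-empty n ρ ρ' ρ'' i)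

  renF2-fuse : ∀ {Δ Δ' Δ''} (ρ : Ren Δ' Δ'') (ρ' : Ren Δ Δ') (ρ'' : Ren Δ Δ'') → (∀ {k} (i : Δ ∋ k) → ρ (ρ' i) ≡ ρ'' i)
             → (F : F2 Δ) → renF2 S ρ (renF2 S ρ' F) ≡ renF2 S ρ'' F
  renF2-fuse ρ ρ' ρ'' e F = trans (renF2-sub1 ρ _) (trans (cong (sub1 S _) (renF2-sub1 ρ' F))
      (trans (sub1-fuse _ _ F) (trans (sub1-ext e' F) (sym (renF2-sub1 ρ'' F)))))
    where
    e' : ∀ {k} (i : _ ∋ k) → ((λ j → idv1 S (ρ j)) ∘₁ (λ j → idv1 S (ρ' j))) i ≡ idv1 S (ρ'' i)
    e' {fo} i = cong bvar (e i)
    e' {so m} i = cong bound (e i)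

  wkVal2Fos-inj₂ : ∀ {n} (m : ℕ) (F : F2 (fos n ++ [])) → wkVal2Fos {Δ = []} m (inj₂ F) ≡ inj₂ (renF2 S (liftN n fromEmpty) F)
  wkVal2Fos-inj₂ zero F = cong inj₂ (sym (trans (renF2-sub1 _ F) (sub1-id e F)))
    where
    lid : ∀ n {k} (i : (fos n ++ []) ∋ k) → liftN n (fromEmpty {[]}) i ≡ i
    lid zero ()
    lid (suc n) here = refl
    lid (suc n) (there i) = cong there (lid n i)
    e : ∀ {k} (i : _ ∋ k) → idv1 S (liftN _ fromEmpty i) ≡ idv1 S i
    e {fo} i = cong bvar (lid _ i)
    e {so m} i = cong bound (lid _ i)
  wkVal2Fos-inj₂ {n} (suc m) F = trans (cong (wkV2 S) (wkVal2Fos-inj₂ m F))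
      (cong inj₂ (renF2-fuse (liftN n there) (liftN n fromEmpty) (liftN n fromEmpty) (liftN-empty n there fromEmpty fromEmpty) F))

  -- xs lists x₁ … xₙ outermost first while inst reads its arguments innermost first, so
  -- applying an abstraction to xs reverses its bound variables; hence the comprehension
  -- witness is applyToArgs of λx⃗.G rather than λx⃗.G itself.
  applyToArgs : ∀ n → F2 (fos n ++ []) → F2 (fos n ++ [])
  applyToArgs n F = appV S (wkVal2Fos {Δ = []} n (inj₂ F)) (xs S n)

  reverseArgs : ∀ n → Sub1 S (fos n ++ []) (fos n ++ [])
  reverseArgs n {fo} i = inst S (xs S n) (liftN n fromEmpty i)
  reverseArgs n {so m} i = ⊥-elim (fos-no-so n i)

  applyToArgs-reverseArgs : ∀ n (F : F2 (fos n ++ [])) → applyToArgs n F ≡ sub1 S (reverseArgs n) F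
  applyToArgs-reverseArgs n F = trans (cong (λ v → appV S v (xs S n)) (wkVal2Fos-inj₂ n F))
      (trans (cong (sub1 S (inst S (xs S n))) (renF2-sub1 (liftN n fromEmpty) F)) (trans (sub1-fuse _ _ F) (sub1-ext e F)))
    where
    e : ∀ {k} (i : _ ∋ k) → (inst S (xs S n) ∘₁ (λ j → idv1 S (liftN n fromEmpty j))) i ≡ reverseArgs n i
    e {fo} i = refl
    e {so m} i = ⊥-elim (fos-no-so n i)

  reverseArgs-foIndex : ∀ n j → reverseArgs n (foIndex n j) ≡ bvar (foIndex n (opposite j))
  reverseArgs-foIndex n j = trans (cong (inst S (xs S n)) (liftN-ix n fromEmpty j)) (trans (inst-ix (xs S n) j) (xs-lookup n j))

  applyToArgs-involutive : ∀ n (F : F2 (fos n ++ [])) → applyToArgs n (applyToArgs n F) ≡ F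
  applyToArgs-involutive n F = trans (applyToArgs-reverseArgs n _) (trans (cong (sub1 S (reverseArgs n)) (applyToArgs-reverseArgs n F)) (trans (sub1-fuse _ _ F) (sub1-id e F)))
    where
    e : ∀ {k} (i : _ ∋ k) → (reverseArgs n ∘₁ reverseArgs n) i ≡ idv1 S i
    e {so m} i = ⊥-elim (fos-no-so n i)
    e {fo} i with foIndex-surjective n i
    ... | j , refl = trans (cong (subT S (reverseArgs n)) (reverseArgs-foIndex n j)) (trans (reverseArgs-foIndex n (opposite j)) (cong (λ j' → bvar (foIndex n j')) (opposite-involutive j)))

  allQ-intro : ∀ Ξ K (F : F2 K) → (∀ (σ : Sub1 S K []) → Ξ ⊢ sub1 S σ F) → Ξ ⊢ allQ S K F
  allQ-intro Ξ [] F H = coe (sub1-id (λ ()) F) (H (λ ()))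
  allQ-intro Ξ (fo ∷ K) F H = allQ-intro Ξ K (∀₁ F) h
    where
    h : ∀ (σ : Sub1 S K []) → Ξ ⊢ sub1 S σ (∀₁ F)
    h σ = ∀₁I z (fresh-FO-Γ Ξ (sub1 S σ (∀₁ F))) (fresh-FO-C Ξ (sub1 S σ (∀₁ F))) (coe (sym (open₁-lift1 σ (fvar z) F)) (H (extSub1 σ (fvar z))))
      where z = fresh Ξ (sub1 S σ (∀₁ F))
  allQ-intro Ξ (so m ∷ K) F H = allQ-intro Ξ K (∀₂ m F) h
    where
    h : ∀ (σ : Sub1 S K []) → Ξ ⊢ sub1 S σ (∀₂ m F)
    h σ = ∀₂I z (fresh-SO-Γ Ξ (sub1 S σ (∀₂ m F)) m) (fresh-SO-C Ξ (sub1 S σ (∀₂ m F)) m) (coe (sym (open₂-lift1-var σ z F)) (H (extSub1 σ (free z))))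
      where z = fresh Ξ (sub1 S σ (∀₂ m F))

  allFO-intro : ∀ Ξ n (F : F2 (fos n ++ [])) → (∀ (τ : Sub1 S (fos n ++ []) []) → Ξ ⊢ sub1 S τ F) → Ξ ⊢ allFO S n F
  allFO-intro Ξ zero F H = coe (sub1-id (λ ()) F) (H (λ ()))
  allFO-intro Ξ (suc n) F H = allFO-intro Ξ n (∀₁ F) h
    where
    h : ∀ (τ : Sub1 S (fos n ++ []) []) → Ξ ⊢ sub1 S τ (∀₁ F)
    h τ = ∀₁I z (fresh-FO-Γ Ξ (sub1 S τ (∀₁ F))) (fresh-FO-C Ξ (sub1 S τ (∀₁ F))) (coe (sym (open₁-lift1 τ (fvar z) F)) (H (extSub1 τ (fvar z))))
      where z = fresh Ξ (sub1 S τ (∀₁ F))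

  comp-derivable : ∀ Ξ K n (G : F2 (fos n ++ K)) → Ξ ⊢ comp S K n G
  comp-derivable Ξ K n G = allQ-intro Ξ K _ body
    where
    Gw = renF2 S (liftN n there) G
    Xx : F2 (fos n ++ so n ∷ K)
    Xx = app n (bound (wkFos n here)) (xs S n)
    Bd = allFO S n (_⇔_ S Gw Xx)
    body : ∀ (σ : Sub1 S K []) → Ξ ⊢ sub1 S σ (∃₂ n Bd)
    body σ = ∃₂I H (coe (sym eqO) (allFO-intro Ξ n _ biimp))
      where
      Σ0 : Sub2 S K []
      Σ0 {fo} i = σ i
      Σ0 {so m} i = inj₁ (σ i)
      Gσ = sub2 S (lift2Fos n Σ0) G
      H = applyToArgs n Gσ
      Σ' : Sub2 S (so n ∷ K) []
      Σ' = open₂Sub (inj₂ H) ∘₂₁ lift1 S σ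
      Lf = lift2Fos n Σ'
      eqO : open₂ S (sub1 S (lift1 S σ) Bd) (inj₂ H) ≡ allFO S n (sub2 S Lf (_⇔_ S Gw Xx))
      eqO = trans (open₂-sub2 (sub1 S (lift1 S σ) Bd) (inj₂ H)) (trans (sub21-fuse (open₂Sub (inj₂ H)) (lift1 S σ) Bd) (sub2-allFO n Σ' _))
      base : ∀ {k} (i : K ∋ k) → Σ' (there i) ≡ Σ0 i
      base {fo} i = trans (subT-fuse _ _ (σ i)) (subT-id (λ j → refl) (σ i))
      base {so m} i with σ i
      ... | bound j = refl
      ... | free X = refl
      lifted : ∀ m {k} (i : (fos m ++ K) ∋ k) → lift2Fos m Σ' (liftN m there i) ≡ lift2Fos m Σ0 i
      lifted zero i = base i
      lifted (suc m) here = refl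
      lifted (suc m) (there i) = cong (wkV2 S) (lifted m i)
      e : ∀ {k} (i : (fos n ++ K) ∋ k) → (Lf ∘₂₁ (λ j → idv1 S (liftN n there j))) i ≡ lift2Fos n Σ0 i
      e {fo} i = lifted n i
      e {so m} i = lifted n i
      eqP : sub2 S Lf Gw ≡ Gσ
      eqP = trans (cong (sub2 S Lf) (renF2-sub1 (liftN n there) G)) (trans (sub21-fuse Lf _ G) (sub2-ext e G))
      eqQ : sub2 S Lf Xx ≡ Gσ
      eqQ = trans (cong₂ (appV S) (lift2Fos-wkFos n Σ') (subTs-xs n Σ')) (applyToArgs-involutive n Gσ)
      biimp : ∀ (τ : Sub1 S (fos n ++ []) []) → Ξ ⊢ sub1 S τ (sub2 S Lf (_⇔_ S Gw Xx))
      biimp τ = ∧I (⇒I (coe eqPQ (hyp (here refl)))) (⇒I (coe (sym eqPQ) (hyp (here refl))))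
        where
        eqPQ : sub1 S τ (sub2 S Lf Gw) ≡ sub1 S τ (sub2 S Lf Xx)
        eqPQ = cong (sub1 S τ) (trans eqP (sym eqQ))

module Conservativity (S : Signature) (φ : (n : ℕ) → ℕ ⤖ ℕ) where
  open Syntax S
  open Naming φ

  mutual
    FOT-sub⁺ : ∀ {Δ Δ'} x (σ : Δ ∋ fo → Tm Δ') (t : Tm Δ) → FOT S x t → FOT S x (subT S σ t)
    FOT-sub⁺ x σ (bvar i) ()
    FOT-sub⁺ x σ (fvar y) o = o
    FOT-sub⁺ x σ (fun f ts) o = FOTs-sub⁺ x σ ts o

    FOTs-sub⁺ : ∀ {Δ Δ' n} x (σ : Δ ∋ fo → Tm Δ') (ts : Vec (Tm Δ) n) → FOTs S x ts → FOTs S x (subTs S σ ts)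
    FOTs-sub⁺ x σ (t ∷ ts) (inj₁ o) = inj₁ (FOT-sub⁺ x σ t o)
    FOTs-sub⁺ x σ (t ∷ ts) (inj₂ o) = inj₂ (FOTs-sub⁺ x σ ts o)

  FO1-code : ∀ {Δ} x (X : F2 Δ) → FO2 S x X → FO1 S x (code S φ X)
  FO1-code x ⊥ᶠ ()
  FO1-code x (app n (bound i) ts) o = inj₂ (FOTs-sub⁺ x _ ts o)
  FO1-code x (app n (free Y) ts) o = inj₂ (FOTs-sub⁺ x _ ts o)
  FO1-code x (X ⇒ Y) (inj₁ o) = inj₁ (FO1-code x X o)
  FO1-code x (X ⇒ Y) (inj₂ o) = inj₂ (FO1-code x Y o)
  FO1-code x (X ∧ Y) (inj₁ o) = inj₁ (FO1-code x X o)
  FO1-code x (X ∧ Y) (inj₂ o) = inj₂ (FO1-code x Y o)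
  FO1-code x (X ∨ Y) (inj₁ o) = inj₁ (FO1-code x X o)
  FO1-code x (X ∨ Y) (inj₂ o) = inj₂ (FO1-code x Y o)
  FO1-code x (∀₁ X) o = FO1-code x X o
  FO1-code x (∃₁ X) o = FO1-code x X o
  FO1-code x (∀₂ n X) o = FO1-code x X o
  FO1-code x (∃₂ n X) o = FO1-code x X o

  FO1-code-SO : ∀ {Δ} m Y (X : F2 Δ) → SO2 S m Y X → FO1 S (to m Y) (code S φ X)
  FO1-code-SO m Y ⊥ᶠ ()
  FO1-code-SO m Y (app n (bound i) ts) ()
  FO1-code-SO m Y (app n (free Z) ts) (refl , refl) = inj₁ refl
  FO1-code-SO m Y (X ⇒ Z) (inj₁ o) = inj₁ (FO1-code-SO m Y X o)
  FO1-code-SO m Y (X ⇒ Z) (inj₂ o) = inj₂ (FO1-code-SO m Y Z o)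
  FO1-code-SO m Y (X ∧ Z) (inj₁ o) = inj₁ (FO1-code-SO m Y X o)
  FO1-code-SO m Y (X ∧ Z) (inj₂ o) = inj₂ (FO1-code-SO m Y Z o)
  FO1-code-SO m Y (X ∨ Z) (inj₁ o) = inj₁ (FO1-code-SO m Y X o)
  FO1-code-SO m Y (X ∨ Z) (inj₂ o) = inj₂ (FO1-code-SO m Y Z o)
  FO1-code-SO m Y (∀₁ X) o = FO1-code-SO m Y X o
  FO1-code-SO m Y (∃₁ X) o = FO1-code-SO m Y X o
  FO1-code-SO m Y (∀₂ n X) o = FO1-code-SO m Y X o
  FO1-code-SO m Y (∃₂ n X) o = FO1-code-SO m Y X o

  arityBound : ∀ {Δ} → F2 Δ → ℕ
  arityBound ⊥ᶠ = 0
  arityBound (app n v ts) = n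
  arityBound (X ⇒ Y) = arityBound X + arityBound Y
  arityBound (X ∧ Y) = arityBound X + arityBound Y
  arityBound (X ∨ Y) = arityBound X + arityBound Y
  arityBound (∀₁ X) = arityBound X
  arityBound (∃₁ X) = arityBound X
  arityBound (∀₂ n X) = arityBound X
  arityBound (∃₂ n X) = arityBound X

  aritiesWithin : ∀ N {Δ} (X : F2 Δ) → arityBound X ≤ N → Decoding.AritiesWithin S φ N X
  aritiesWithin N ⊥ᶠ p = tt
  aritiesWithin N (app n v ts) p = p
  aritiesWithin N (X ⇒ Y) p = aritiesWithin N X (≤-trans (m≤m+n _ _) p) , aritiesWithin N Y (≤-trans (m≤n+m _ _) p)
  aritiesWithin N (X ∧ Y) p = aritiesWithin N X (≤-trans (m≤m+n _ _) p) , aritiesWithin N Y (≤-trans (m≤n+m _ _) p)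
  aritiesWithin N (X ∨ Y) p = aritiesWithin N X (≤-trans (m≤m+n _ _) p) , aritiesWithin N Y (≤-trans (m≤n+m _ _) p)
  aritiesWithin N (∀₁ X) p = aritiesWithin N X p
  aritiesWithin N (∃₁ X) p = aritiesWithin N X p
  aritiesWithin N (∀₂ n X) p = aritiesWithin N X p
  aritiesWithin N (∃₂ n X) p = aritiesWithin N X p

  module _ (k : Logic) (Γ : Form2₀ S → Set) where

    Hyp₁ : Form1₀ S → Set
    Hyp₁ F = star S φ Γ F ⊎ SC1 S φ F

    sources : (L : List (Form1₀ S)) → All Hyp₁ L → List (Form2₀ S)
    sources [] [] = []
    sources (_ ∷ L) (inj₁ (F , _ , _) ∷ hs) = F ∷ sources L hs
    sources (_ ∷ L) (inj₂ _ ∷ hs) = sources L hs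

    sources-Γ : (L : List (Form1₀ S)) (hs : All Hyp₁ L) → All Γ (sources L hs)
    sources-Γ [] [] = []
    sources-Γ (_ ∷ L) (inj₁ (F , F∈Γ , _) ∷ hs) = F∈Γ ∷ sources-Γ L hs
    sources-Γ (_ ∷ L) (inj₂ _ ∷ hs) = sources-Γ L hs

    arityBoundL : (L : List (Form1₀ S)) → All Hyp₁ L → ℕ
    arityBoundL [] [] = 0
    arityBoundL (_ ∷ L) (inj₁ (F , _ , _) ∷ hs) = arityBound F + arityBoundL L hs
    arityBoundL (_ ∷ L) (inj₂ (F , _ , _) ∷ hs) = arityBound F + arityBoundL L hs

    module _ (N : ℕ) where
      open Decoding S φ N
      open Derivations S φ N k

      sources-covered : (L : List (Form1₀ S)) (hs : All Hyp₁ L) → Covers L (sources L hs)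
      sources-covered [] [] x _ = [] , λ m → []
      sources-covered (_ ∷ L) (inj₁ (F , _ , refl) ∷ hs) x (x∉F ∷ x∉L) =
        ((λ o → x∉F (FO1-code x F o)) ∷ proj₁ (sources-covered L hs x x∉L)) ,
        λ m → (λ o → x∉F (subst (λ z → FO1 S z (code S φ F)) (to-from m x) (FO1-code-SO m (from m x) F o)))
              ∷ proj₂ (sources-covered L hs x x∉L) m
      sources-covered (_ ∷ L) (inj₂ _ ∷ hs) x (_ ∷ x∉L) = sources-covered L hs x x∉L

      decode-hyps : ∀ {Ξ} (L : List (Form1₀ S)) (hs : All Hyp₁ L) → arityBoundL L hs ≤ N
                  → (∀ {F} → F ∈ sources L hs → F ∈ Ξ) → All (Ξ ⊢_) (map decode₀ L)
      decode-hyps [] [] _ _ = []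
      decode-hyps (_ ∷ L) (inj₁ (F , _ , refl) ∷ hs) b sub =
        ⊢decode₀-code F (aritiesWithin N F (≤-trans (m≤m+n _ _) b)) (hyp (sub (here refl)))
        ∷ decode-hyps L hs (≤-trans (m≤n+m _ _) b) (sub ∘ there)
      decode-hyps (_ ∷ L) (inj₂ (F , (K , n , G , _ , refl) , refl) ∷ hs) b sub =
        ⊢decode₀-code F (aritiesWithin N F (≤-trans (m≤m+n _ _) b)) (comp-derivable _ K n G)
        ∷ decode-hyps L hs (≤-trans (m≤n+m _ _) b) sub

    conservative : ∀ (A : Form2₀ S) L (hs : All Hyp₁ L) → _⊢₁[_]_ S L k (code S φ A) → _⊢₂[_]_ S (sources L hs) k A
    conservative A L hs d =
      decode₀-code⊢ A (aritiesWithin N A (m≤m+n _ _))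
        (cutAll (decode-hyps N L hs (m≤n+m _ _) id) (decode-sound d _ (sources-covered N L hs)))
      where
      N = arityBound A + arityBoundL L hs
      open Derivations S φ N k

theorem2 : (S : Signature) (φ : (n : ℕ) → ℕ ⤖ ℕ) (k : Logic)
           (Γ : Form2₀ S → Set) (A : Form2₀ S)
           → Derivable1 S k (λ F → star S φ Γ F ⊎ SC1 S φ F) (code S φ A)
           → Derivable2 S k Γ A
theorem2 S φ k Γ A (L , hs , d) = sources k Γ L hs , sources-Γ k Γ L hs , conservative k Γ A L hs d
  where open Conservativity S φ
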